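{- Let $m\ge1$ be an integer and $b$ a complex number. Let $f_m(z,0,b)=\sum_{n\ge0}c(n,m,0,b)z^n$ be the unique formal power series with $f_m=1+bz^mf_m^2$ and $d_1^{(m)}(N,0,b)=\det\big(c(i+j+1,m,0,b)\big)_{i,j=0}^{N-1}$. Then for all $n\ge0$ $$d_1^{(m)}(mn,0,b)=(-1)^{\binom m2n}b^{mn^2},$$ and $d_1^{(m)}(N,0,b)=0$ for all $N$ not divisible by $m$.
   Context: The determinant of a $0\times0$ matrix is $1$. -}

module Defs where

open import Level using (Level)
open import Data.Nat using (ℕ; zero; suc; _∸_; _<ᵇ_)
open import Data.Bool using (if_then_else_)
open import Data.Fin using (Fin; toℕ; punchIn)
import Data.Fin as F
open import Algebra.Bundles using (CommutativeRing)

module Ops {c ℓ : Level} (R : CommutativeRing c ℓ) where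
  open CommutativeRing R

  pow : Carrier → ℕ → Carrier
  pow x zero    = 1#
  pow x (suc k) = x * pow x k

  signPow : ℕ → Carrier
  signPow k = pow (- 1#) k

  sumFin : (n : ℕ) → (Fin n → Carrier) → Carrier
  sumFin zero    g = 0#
  sumFin (suc n) g = g F.zero + sumFin n (λ i → g (F.suc i))

  det : (n : ℕ) → (Fin n → Fin n → Carrier) → Carrier
  det zero    M = 1#
  det (suc n) M =
    sumFin (suc n) (λ j →
      signPow (toℕ j) * (M F.zero j * det n (λ i k → M (F.suc i) (punchIn j k))))

  PowerSeries : Set c
  PowerSeries = ℕ → Carrier

  one : PowerSeries
  one zero    = 1#
  one (suc n) = 0#

  _·_ : PowerSeries → PowerSeries → PowerSeries
  (f · g) n = sumFin (suc n) (λ i → f (toℕ i) * g (n ∸ toℕ i))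

  shift : ℕ → PowerSeries → PowerSeries
  shift m f n = if n <ᵇ m then 0# else f (n ∸ m)

  scale : Carrier → PowerSeries → PowerSeries
  scale b f n = b * f n

  _⊕_ : PowerSeries → PowerSeries → PowerSeries
  (f ⊕ g) n = f n + g n

  _≋_ : PowerSeries → PowerSeries → Set ℓ
  f ≋ g = ∀ n → f n ≈ g n

  SatisfiesEq : ℕ → Carrier → PowerSeries → Set ℓ
  SatisfiesEq m b f = f ≋ (one ⊕ scale b (shift m (f · f)))

  d₁ : PowerSeries → ℕ → Carrier
  d₁ f N = det N (λ i j → f (suc (toℕ i Data.Nat.+ toℕ j)))

module Submission where

-- Hankel determinants of the series f = 1 + b z^m f² (m ≥ 1); c(n) are its
-- coefficients and H_N = (c(i+j+1))_{i,j<N}, so d₁ f N = det H_N.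
-- 1. c(n) = 0 unless m ∣ n, and F(k) = c(mk) satisfies F = 1 + b z F².  Then
--    S = F² = 1 + 2bzS + b²z²S², so the table B(n,k) = [zⁿ] z^k S^(k+1)
--    satisfies B(n+1,k) = B(n,k-1) + 2b B(n,k) + b² B(n,k+1); this operator is
--    self-adjoint for the weights b^(2k+1), giving the orthogonality relation
--    Σ_k B(i,k) B(j,k) b^(2k+1) = b S(i+j) = F(i+j+1).
-- 2. Hence H = L U with L lower unitriangular (L(i,k) = B(⌊i/m⌋,⌊k/m⌋) when
--    i ≡ k mod m) and U(i,j) = b^(2q+1) B(⌊j/m⌋,q), q = ⌊i/m⌋, when
--    (i mod m) + (j mod m) = m-1 (both 0 otherwise); so det H_N = det U_N.
-- 3. If m ∤ N, row m⌊N/m⌋ of U_N vanishes.  The last m rows of U_{m(n+1)} each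
--    have one nonzero entry b^(2n+1), so det U_{m(n+1)} = (-1)^C(m,2)
--    b^(m(2n+1)) det U_{mn}.

open import Defs
open import Level using (Level; _⊔_)
open import Data.Nat as ℕ using (ℕ; zero; suc; z≤n; s≤s)
import Data.Nat.Properties as ℕP
open import Data.Nat.DivMod using (_%_; _/_)
import Data.Nat.DivMod as DM
open import Data.Nat.Divisibility using (_∣_; divides; _∣?_)
import Data.Nat.Divisibility as ND
open import Data.Nat.Tactic.RingSolver using (solve-∀)
open import Data.Nat.Combinatorics using (_C_; nC1≡n; nCk+nC[k+1]≡[n+1]C[k+1])
open import Data.Fin as F using (Fin; toℕ; punchIn; punchOut)
import Data.Fin.Properties as FP
open import Relation.Binary.PropositionalEquality as ≡ using (_≡_; _≢_)
open import Relation.Nullary using (¬_; Dec; yes; no)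
open import Data.Empty using (⊥-elim)
open import Data.Product using (_×_; _,_)
open import Data.Bool using (true; false)
open import Algebra.Bundles using (CommutativeRing)
import Relation.Binary.Reasoning.Setoid as SetoidReasoning
import Algebra.Properties.Ring as RingProperties
import Algebra.Properties.CommutativeSemigroup as CommutativeSemigroupProperties
import Algebra.Solver.Ring.NaturalCoefficients.Default as RingSolver

module FiniteSums {c ℓ : Level} (R : CommutativeRing c ℓ) where
  open CommutativeRing R
  open Ops R using (sumFin)
  open CommutativeSemigroupProperties +-commutativeSemigroup using (interchange)

  sumFin-cong : ∀ n {g h : Fin n → Carrier} → (∀ i → g i ≈ h i) → sumFin n g ≈ sumFin n h
  sumFin-cong zero    e = refl
  sumFin-cong (suc n) e = +-cong (e F.zero) (sumFin-cong n (λ i → e (F.suc i)))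

  sumFin-+ : ∀ n (g h : Fin n → Carrier) → sumFin n (λ i → g i + h i) ≈ sumFin n g + sumFin n h
  sumFin-+ zero    g h = sym (+-identityˡ 0#)
  sumFin-+ (suc n) g h = trans (+-congˡ (sumFin-+ n _ _)) (interchange _ _ _ _)

  sumFin-*ˡ : ∀ n x (g : Fin n → Carrier) → sumFin n (λ i → x * g i) ≈ x * sumFin n g
  sumFin-*ˡ zero    x g = sym (zeroʳ x)
  sumFin-*ˡ (suc n) x g = trans (+-congˡ (sumFin-*ˡ n x _)) (sym (distribˡ x _ _))

  sumFin-0 : ∀ n (g : Fin n → Carrier) → (∀ i → g i ≈ 0#) → sumFin n g ≈ 0#
  sumFin-0 zero    g e = refl
  sumFin-0 (suc n) g e = trans (+-cong (e F.zero) (sumFin-0 n _ (λ i → e (F.suc i)))) (+-identityˡ 0#)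

  sumFin-single : ∀ n (g : Fin n → Carrier) (i₀ : Fin n) → (∀ i → i ≢ i₀ → g i ≈ 0#) →
    sumFin n g ≈ g i₀
  sumFin-single (suc n) g F.zero e =
    trans (+-congˡ (sumFin-0 n _ (λ i → e (F.suc i) (λ ())))) (+-identityʳ _)
  sumFin-single (suc n) g (F.suc i₀) e =
    trans (+-cong (e F.zero (λ ())) (sumFin-single n _ i₀ (λ i i≢i₀ → e (F.suc i) (λ eq → i≢i₀ (FP.suc-injective eq)))))
          (+-identityˡ _)

  sumFin-swap : ∀ n k (g : Fin n → Fin k → Carrier) →
    sumFin n (λ i → sumFin k (λ j → g i j)) ≈ sumFin k (λ j → sumFin n (λ i → g i j))
  sumFin-swap zero    k g = sym (sumFin-0 k _ (λ _ → refl))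
  sumFin-swap (suc n) k g = trans (+-congˡ (sumFin-swap n k _)) (sym (sumFin-+ k _ _))

  Σ : ℕ → (ℕ → Carrier) → Carrier
  Σ n g = sumFin n (λ i → g (toℕ i))

  Σ-cong : ∀ n {g h : ℕ → Carrier} → (∀ i → i ℕ.< n → g i ≈ h i) → Σ n g ≈ Σ n h
  Σ-cong n e = sumFin-cong n (λ i → e (toℕ i) (FP.toℕ<n i))

  Σ-0 : ∀ n (g : ℕ → Carrier) → (∀ i → i ℕ.< n → g i ≈ 0#) → Σ n g ≈ 0#
  Σ-0 n g e = sumFin-0 n _ (λ i → e (toℕ i) (FP.toℕ<n i))

  Σ-+ : ∀ n (g h : ℕ → Carrier) → Σ n (λ i → g i + h i) ≈ Σ n g + Σ n h
  Σ-+ n g h = sumFin-+ n _ _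

  Σ-*ˡ : ∀ n x (g : ℕ → Carrier) → Σ n (λ i → x * g i) ≈ x * Σ n g
  Σ-*ˡ n x g = sumFin-*ˡ n x _

  Σ-last : ∀ n (g : ℕ → Carrier) → Σ (suc n) g ≈ Σ n g + g n
  Σ-last zero    g = trans (+-identityʳ _) (sym (+-identityˡ _))
  Σ-last (suc n) g = trans (+-congˡ (Σ-last n (λ i → g (suc i)))) (sym (+-assoc _ _ _))

  Σ-split : ∀ a b (g : ℕ → Carrier) → Σ (a ℕ.+ b) g ≈ Σ a g + Σ b (λ i → g (a ℕ.+ i))
  Σ-split zero    b g = sym (+-identityˡ _)
  Σ-split (suc a) b g = trans (+-congˡ (Σ-split a b (λ i → g (suc i)))) (sym (+-assoc _ _ _))

  Σ-extend : ∀ K d (g : ℕ → Carrier) → (∀ k → K ℕ.≤ k → k ℕ.< K ℕ.+ d → g k ≈ 0#) →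
    Σ (K ℕ.+ d) g ≈ Σ K g
  Σ-extend K d g e = trans (Σ-split K d g)
    (trans (+-congˡ (Σ-0 d _ (λ i i<d → e (K ℕ.+ i) (ℕP.m≤m+n K i) (ℕP.+-monoʳ-< K i<d)))) (+-identityʳ _))

module Powers {c ℓ : Level} (R : CommutativeRing c ℓ) where
  open CommutativeRing R
  open Ops R using (pow; signPow)
  open RingProperties ring using (-1*x≈-x; -‿involutive)
  open SetoidReasoning setoid

  pow-cong : ∀ {x y} k → x ≈ y → pow x k ≈ pow y k
  pow-cong zero    e = refl
  pow-cong (suc k) e = *-cong e (pow-cong k e)

  pow-one : ∀ k → pow 1# k ≈ 1#
  pow-one zero    = refl
  pow-one (suc k) = trans (*-identityˡ _) (pow-one k)

  pow-+ : ∀ x a d → pow x (a ℕ.+ d) ≈ pow x a * pow x d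
  pow-+ x zero    d = sym (*-identityˡ _)
  pow-+ x (suc a) d = trans (*-congˡ (pow-+ x a d)) (sym (*-assoc _ _ _))

  pow-* : ∀ x a d → pow x (a ℕ.* d) ≈ pow (pow x a) d
  pow-* x a zero    = reflexive (≡.cong (pow x) (ℕP.*-zeroʳ a))
  pow-* x a (suc d) = begin
    pow x (a ℕ.* suc d)         ≡⟨ ≡.cong (pow x) (ℕP.*-suc a d) ⟩
    pow x (a ℕ.+ a ℕ.* d)       ≈⟨ pow-+ x a (a ℕ.* d) ⟩
    pow x a * pow x (a ℕ.* d)   ≈⟨ *-congˡ (pow-* x a d) ⟩
    pow x a * pow (pow x a) d   ∎

  pow-square : ∀ x k → pow (x * x) k ≈ pow x (k ℕ.+ k)
  pow-square x zero    = refl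
  pow-square x (suc k) = begin
    (x * x) * pow (x * x) k        ≈⟨ *-congˡ (pow-square x k) ⟩
    (x * x) * pow x (k ℕ.+ k)      ≈⟨ *-assoc x x _ ⟩
    x * (x * pow x (k ℕ.+ k))      ≡⟨ ≡.cong (λ e → x * pow x e) (≡.sym (ℕP.+-suc k k)) ⟩
    x * pow x (k ℕ.+ suc k)        ∎

  signPow-+ : ∀ a d → signPow (a ℕ.+ d) ≈ signPow a * signPow d
  signPow-+ = pow-+ (- 1#)

  signPow-square : ∀ k → signPow k * signPow k ≈ 1#
  signPow-square k = begin
    signPow k * signPow k     ≈⟨ sym (signPow-+ k k) ⟩
    pow (- 1#) (k ℕ.+ k)      ≈⟨ sym (pow-square (- 1#) k) ⟩
    pow (- 1# * - 1#) k       ≈⟨ pow-cong k (trans (-1*x≈-x (- 1#)) (-‿involutive 1#)) ⟩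
    pow 1# k                  ≈⟨ pow-one k ⟩
    1#                        ∎

  signPow-cancel : ∀ k x → signPow k * (signPow k * x) ≈ x
  signPow-cancel k x = trans (sym (*-assoc _ _ _)) (trans (*-congʳ (signPow-square k)) (*-identityˡ x))

  -- The sign of an entry in row a + v and column a.
  signPow-shift : ∀ a v x → signPow (a ℕ.+ v) * (signPow a * x) ≈ signPow v * x
  signPow-shift a v x = begin
    signPow (a ℕ.+ v) * (signPow a * x)       ≈⟨ *-congʳ (trans (signPow-+ a v) (*-comm _ _)) ⟩
    (signPow v * signPow a) * (signPow a * x) ≈⟨ *-assoc _ _ _ ⟩
    signPow v * (signPow a * (signPow a * x)) ≈⟨ *-congˡ (signPow-cancel a x) ⟩
    signPow v * x                             ∎

module Determinants {c ℓ : Level} (R : CommutativeRing c ℓ) where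
  open CommutativeRing R
  open Ops R
  open FiniteSums R
  open Powers R
  open RingProperties ring using (-1*x≈-x; +-inverseʳ-unique)
  open RingSolver commutativeSemiring using (solve; _:=_; _:*_)
  open SetoidReasoning setoid

  Matrix : ℕ → Set c
  Matrix n = Fin n → Fin n → Carrier

  laplaceTerm : ∀ n → (Fin (suc n) → Carrier) → (Fin n → Fin (suc n) → Carrier) → Fin (suc n) → Carrier
  laplaceTerm n v rows j = signPow (toℕ j) * (v j * det n (λ i k → rows i (punchIn j k)))

  laplace : ∀ n → (Fin (suc n) → Carrier) → (Fin n → Fin (suc n) → Carrier) → Carrier
  laplace n v rows = sumFin (suc n) (laplaceTerm n v rows)

  det-cong : ∀ n {M M′ : Matrix n} → (∀ i j → M i j ≈ M′ i j) → det n M ≈ det n M′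
  laplace-cong : ∀ n {v v′ : Fin (suc n) → Carrier} {rows rows′ : Fin n → Fin (suc n) → Carrier} →
    (∀ j → v j ≈ v′ j) → (∀ i j → rows i j ≈ rows′ i j) → laplace n v rows ≈ laplace n v′ rows′

  det-cong zero    e = refl
  det-cong (suc n) e = laplace-cong n (e F.zero) (λ i → e (F.suc i))

  laplace-cong n {v} {v′} {rows} {rows′} ev er = sumFin-cong (suc n) {laplaceTerm n v rows} {laplaceTerm n v′ rows′}
    (λ j → *-congˡ (*-cong (ev j) (det-cong n (λ i k → er i (punchIn j k)))))

  laplace-linear : ∀ n (u v : Fin (suc n) → Carrier) x (rows : Fin n → Fin (suc n) → Carrier) →
    laplace n (λ j → u j + x * v j) rows ≈ laplace n u rows + x * laplace n v rows
  laplace-linear n u v x rows = begin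
    sumFin (suc n) (λ j → s j * ((u j + x * v j) * D j))
      ≈⟨ sumFin-cong (suc n) {λ j → s j * ((u j + x * v j) * D j)} {λ j → term u j + x * term v j}
           (λ j → distribute (s j) (u j) (v j) (D j)) ⟩
    sumFin (suc n) (λ j → term u j + x * term v j)
      ≈⟨ sumFin-+ (suc n) (term u) (λ j → x * term v j) ⟩
    laplace n u rows + sumFin (suc n) (λ j → x * term v j)
      ≈⟨ +-congˡ (sumFin-*ˡ (suc n) x (term v)) ⟩
    laplace n u rows + x * laplace n v rows ∎
    where
    s : Fin (suc n) → Carrier
    s j = signPow (toℕ j)
    D : Fin (suc n) → Carrier
    D j = det n (λ i k → rows i (punchIn j k))
    term : (Fin (suc n) → Carrier) → Fin (suc n) → Carrier
    term w j = s j * (w j * D j)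
    distribute : ∀ σ a b d → σ * ((a + x * b) * d) ≈ σ * (a * d) + x * (σ * (b * d))
    distribute σ a b d = begin
      σ * ((a + x * b) * d)           ≈⟨ *-congˡ (distribʳ d a (x * b)) ⟩
      σ * (a * d + (x * b) * d)       ≈⟨ distribˡ σ _ _ ⟩
      σ * (a * d) + σ * ((x * b) * d) ≈⟨ +-congˡ (solve 4 (λ σ x b d → σ :* ((x :* b) :* d) := x :* (σ :* (b :* d))) refl σ x b d) ⟩
      σ * (a * d) + x * (σ * (b * d)) ∎

  det-column0 : ∀ n (M : Matrix (suc n)) →
    det (suc n) M ≈ sumFin (suc n) (λ i → signPow (toℕ i) * (M i F.zero * det n (λ a b → M (punchIn i a) (F.suc b))))
  det-column0 zero    M = refl
  det-column0 (suc n) M = +-congˡ (begin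
    sumFin (suc n) (λ j → σ j * (x j * det (suc n) (λ p q → M (F.suc p) (punchIn (F.suc j) q))))
      ≈⟨ sumFin-cong (suc n) {λ j → σ j * (x j * det (suc n) (λ p q → M (F.suc p) (punchIn (F.suc j) q)))}
           {λ j → sumFin (suc n) (λ i → P j i)}
           (λ j → trans (*-congˡ (*-congˡ (det-column0 n (λ p q → M (F.suc p) (punchIn (F.suc j) q)))))
                        (sym (scaleSum (σ j) (x j) (λ i → s i * (y i * X i j))))) ⟩
    sumFin (suc n) (λ j → sumFin (suc n) (λ i → P j i))
      ≈⟨ sumFin-swap (suc n) (suc n) P ⟩
    sumFin (suc n) (λ i → sumFin (suc n) (λ j → P j i))
      ≈⟨ sumFin-cong (suc n) {λ i → sumFin (suc n) (λ j → P j i)} {λ i → σ i * (y i * sumFin (suc n) (λ j → s j * (x j * X i j)))}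
           (λ i → trans (sumFin-cong (suc n) {λ j → P j i} {λ j → σ i * (y i * (s j * (x j * X i j)))}
                           (λ j → regroup (s j) (s i) (x j) (y i) (X i j)))
                        (scaleSum (σ i) (y i) (λ j → s j * (x j * X i j)))) ⟩
    sumFin (suc n) (λ i → σ i * (y i * sumFin (suc n) (λ j → s j * (x j * X i j)))) ∎)
    where
    -- Expanding both sides once more, term (0, j+1) of the first row meets
    -- term (i+1, 0) of the first column in the minor X i j without rows 0, i+1
    -- and columns 0, j+1.
    X : Fin (suc n) → Fin (suc n) → Carrier
    X i j = det n (λ p q → M (F.suc (punchIn i p)) (F.suc (punchIn j q)))
    s σ : Fin (suc n) → Carrier
    s i = signPow (toℕ i)
    σ i = - 1# * signPow (toℕ i)
    x y : Fin (suc n) → Carrier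
    x j = M F.zero (F.suc j)
    y i = M (F.suc i) F.zero
    P : Fin (suc n) → Fin (suc n) → Carrier
    P j i = σ j * (x j * (s i * (y i * X i j)))
    scaleSum : ∀ a b (g : Fin (suc n) → Carrier) →
      sumFin (suc n) (λ k → a * (b * g k)) ≈ a * (b * sumFin (suc n) g)
    scaleSum a b g = trans (sumFin-*ˡ (suc n) a (λ k → b * g k)) (*-congˡ (sumFin-*ˡ (suc n) b g))
    regroup : ∀ sj si xj yi d → (- 1# * sj) * (xj * (si * (yi * d))) ≈ (- 1# * si) * (yi * (sj * (xj * d)))
    regroup = solve 6 (λ u sj si xj yi d → (u :* sj) :* (xj :* (si :* (yi :* d))) := (u :* si) :* (yi :* (sj :* (xj :* d)))) refl (- 1#)

  column0Term : ∀ n (M : Matrix (suc n)) → Fin (suc n) → Carrier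
  column0Term n M i = signPow (toℕ i) * (M i F.zero * det n (λ a b → M (punchIn i a) (F.suc b)))

  -- A matrix whose first two rows agree has determinant 0: expanding along
  -- column 0, the terms of rows 0 and 1 cancel and the other minors again have
  -- two equal first rows.
  det-rows01-equal : ∀ n (M : Matrix (suc (suc n))) → (∀ j → M F.zero j ≈ M (F.suc F.zero) j) →
    det (suc (suc n)) M ≈ 0#
  lowerTerms-vanish : ∀ n (M : Matrix (suc (suc n))) → (∀ j → M F.zero j ≈ M (F.suc F.zero) j) →
    sumFin n (λ i → column0Term (suc n) M (F.suc (F.suc i))) ≈ 0#

  lowerTerms-vanish zero    M h = refl
  lowerTerms-vanish (suc n) M h = sumFin-0 (suc n) (λ i → column0Term (suc (suc n)) M (F.suc (F.suc i))) (λ i →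
    trans (*-congˡ (trans (*-congˡ (minorVanishes i)) (zeroʳ _))) (zeroʳ _))
    where
    minorVanishes : ∀ i → det (suc (suc n)) (λ a b → M (punchIn (F.suc (F.suc i)) a) (F.suc b)) ≈ 0#
    minorVanishes i = det-rows01-equal n (λ a b → M (punchIn (F.suc (F.suc i)) a) (F.suc b)) (λ j → h (F.suc j))

  det-rows01-equal n M h = begin
    det (suc (suc n)) M                          ≈⟨ det-column0 (suc n) M ⟩
    term₀ + (term₁ + sumFin n (λ i → column0Term (suc n) M (F.suc (F.suc i))))
                                                 ≈⟨ +-congˡ (+-congˡ (lowerTerms-vanish n M h)) ⟩
    term₀ + (term₁ + 0#)                         ≈⟨ +-cong (*-identityˡ _) (+-identityʳ _) ⟩
    y + term₁                                    ≈⟨ +-congˡ (*-congˡ (*-cong (sym (h F.zero)) (det-cong (suc n) sameMinor))) ⟩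
    y + (- 1# * 1#) * y                          ≈⟨ +-congˡ (trans (*-congʳ (*-identityʳ (- 1#))) (-1*x≈-x y)) ⟩
    y + - y                                      ≈⟨ -‿inverseʳ y ⟩
    0#                                           ∎
    where
    term₀ = column0Term (suc n) M F.zero
    term₁ = column0Term (suc n) M (F.suc F.zero)
    y = M F.zero F.zero * det (suc n) (λ a b → M (F.suc a) (F.suc b))
    sameMinor : ∀ a b → M (punchIn (F.suc F.zero) a) (F.suc b) ≈ M (F.suc a) (F.suc b)
    sameMinor F.zero    b = h (F.suc b)
    sameMinor (F.suc a) b = refl

  consRow : ∀ {n k} → (Fin k → Carrier) → (Fin n → Fin k → Carrier) → Fin (suc n) → Fin k → Carrier
  consRow v A F.zero    = v
  consRow v A (F.suc i) = A i

  det-row1-linear : ∀ n (r₀ u v : Fin (suc (suc n)) → Carrier) x (rest : Fin n → Fin (suc (suc n)) → Carrier) →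
    det (suc (suc n)) (consRow r₀ (consRow (λ j → u j + x * v j) rest))
      ≈ det (suc (suc n)) (consRow r₀ (consRow u rest)) + x * det (suc (suc n)) (consRow r₀ (consRow v rest))
  det-row1-linear n r₀ u v x rest = begin
    sumFin (suc (suc n)) (λ j → s j * (r₀ j * laplace n (λ k → u (punchIn j k) + x * v (punchIn j k)) (rows j)))
      ≈⟨ sumFin-cong (suc (suc n))
           {λ j → s j * (r₀ j * laplace n (λ k → u (punchIn j k) + x * v (punchIn j k)) (rows j))}
           {λ j → term u j + x * term v j}
           (λ j → trans (*-congˡ (*-congˡ (laplace-linear n (λ k → u (punchIn j k)) (λ k → v (punchIn j k)) x (rows j)))) (distribute (s j) (r₀ j) _ _)) ⟩
    sumFin (suc (suc n)) (λ j → term u j + x * term v j)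
      ≈⟨ trans (sumFin-+ (suc (suc n)) (term u) (λ j → x * term v j)) (+-congˡ (sumFin-*ˡ (suc (suc n)) x (term v))) ⟩
    sumFin (suc (suc n)) (term u) + x * sumFin (suc (suc n)) (term v) ∎
    where
    s : Fin (suc (suc n)) → Carrier
    s j = signPow (toℕ j)
    rows : Fin (suc (suc n)) → Fin n → Fin (suc n) → Carrier
    rows j i k = rest i (punchIn j k)
    term : (Fin (suc (suc n)) → Carrier) → Fin (suc (suc n)) → Carrier
    term w j = s j * (r₀ j * laplace n (λ k → w (punchIn j k)) (rows j))
    distribute : ∀ σ a p q → σ * (a * (p + x * q)) ≈ σ * (a * p) + x * (σ * (a * q))
    distribute σ a p q = solve 5 (λ σ a p q y → σ :* (a :* (p :+ y :* q)) := σ :* (a :* p) :+ y :* (σ :* (a :* q))) refl σ a p q x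
      where open RingSolver commutativeSemiring using (_:+_)

  -- Swapping the first two rows negates the determinant (alternating and
  -- bilinear in these rows).
  det-swap01 : ∀ n (r₀ r₁ : Fin (suc (suc n)) → Carrier) (rest : Fin n → Fin (suc (suc n)) → Carrier) →
    det (suc (suc n)) (consRow r₁ (consRow r₀ rest)) ≈ - det (suc (suc n)) (consRow r₀ (consRow r₁ rest))
  det-swap01 n r₀ r₁ rest = +-inverseʳ-unique _ _ (sym (begin
    0#                                          ≈⟨ sym (vanishes w) ⟩
    E w w                                       ≈⟨ laplace-linear (suc n) r₀ r₁ 1# (consRow w rest) ⟩
    E r₀ w + 1# * E r₁ w                        ≈⟨ +-cong (det-row1-linear n r₀ r₀ r₁ 1# rest)
                                                          (*-congˡ (det-row1-linear n r₁ r₀ r₁ 1# rest)) ⟩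
    (E r₀ r₀ + 1# * E r₀ r₁) + 1# * (E r₁ r₀ + 1# * E r₁ r₁)
      ≈⟨ +-cong (+-cong (vanishes r₀) (*-identityˡ _))
                (trans (*-identityˡ _) (+-congˡ (trans (*-identityˡ _) (vanishes r₁)))) ⟩
    (0# + E r₀ r₁) + (E r₁ r₀ + 0#)             ≈⟨ +-cong (+-identityˡ _) (+-identityʳ _) ⟩
    E r₀ r₁ + E r₁ r₀                           ∎))
    where
    w : Fin (suc (suc n)) → Carrier
    w j = r₀ j + 1# * r₁ j
    E : (Fin (suc (suc n)) → Carrier) → (Fin (suc (suc n)) → Carrier) → Carrier
    E a b = det (suc (suc n)) (consRow a (consRow b rest))
    vanishes : ∀ a → E a a ≈ 0#
    vanishes a = det-rows01-equal n (consRow a (consRow a rest)) (λ j → refl)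

  ScalesDet : ∀ n → (Fin n → Fin n) → Carrier → Set (c ⊔ ℓ)
  ScalesDet n σ s = ∀ M → det n (λ i j → M (σ i) j) ≈ s * det n M

  swap01 : ∀ {n} → Fin (suc (suc n)) → Fin (suc (suc n))
  swap01 F.zero               = F.suc F.zero
  swap01 (F.suc F.zero)       = F.zero
  swap01 (F.suc (F.suc i))    = F.suc (F.suc i)

  swap01-scales : ∀ n → ScalesDet (suc (suc n)) swap01 (- 1#)
  swap01-scales n M = begin
    det (suc (suc n)) (λ i j → M (swap01 i) j)    ≈⟨ det-cong (suc (suc n)) swapped ⟩
    det (suc (suc n)) (consRow (M (F.suc F.zero)) (consRow (M F.zero) rest))
                                                  ≈⟨ det-swap01 n (M F.zero) (M (F.suc F.zero)) rest ⟩
    - det (suc (suc n)) (consRow (M F.zero) (consRow (M (F.suc F.zero)) rest))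
                                                  ≈⟨ -‿cong (det-cong (suc (suc n)) unchanged) ⟩
    - det (suc (suc n)) M                         ≈⟨ sym (-1*x≈-x _) ⟩
    - 1# * det (suc (suc n)) M                    ∎
    where
    rest : Fin n → Fin (suc (suc n)) → Carrier
    rest i = M (F.suc (F.suc i))
    swapped : ∀ i j → M (swap01 i) j ≈ consRow (M (F.suc F.zero)) (consRow (M F.zero) rest) i j
    swapped F.zero            j = refl
    swapped (F.suc F.zero)    j = refl
    swapped (F.suc (F.suc i)) j = refl
    unchanged : ∀ i j → consRow (M F.zero) (consRow (M (F.suc F.zero)) rest) i j ≈ M i j
    unchanged F.zero            j = refl
    unchanged (F.suc F.zero)    j = refl
    unchanged (F.suc (F.suc i)) j = refl

  lift : ∀ {n} → (Fin n → Fin n) → Fin (suc n) → Fin (suc n)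
  lift τ F.zero    = F.zero
  lift τ (F.suc i) = F.suc (τ i)

  -- Permuting the rows below the first scales every minor of the first-row
  -- expansion by the same factor.
  lift-scales : ∀ n τ s → ScalesDet n τ s → ScalesDet (suc n) (lift τ) s
  lift-scales n τ s τ-scales M = trans
    (sumFin-cong (suc n) {λ j → t j * (M F.zero j * det n (λ i k → M (F.suc (τ i)) (punchIn j k)))}
                         {λ j → s * (t j * (M F.zero j * det n (λ i k → M (F.suc i) (punchIn j k))))}
      (λ j → trans (*-congˡ (*-congˡ (τ-scales (λ i k → M (F.suc i) (punchIn j k))))) (pull _ _ _)))
    (sumFin-*ˡ (suc n) s (λ j → t j * (M F.zero j * det n (λ i k → M (F.suc i) (punchIn j k)))))
    where
    t : Fin (suc n) → Carrier
    t j = signPow (toℕ j)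
    pull : ∀ a b d → a * (b * (s * d)) ≈ s * (a * (b * d))
    pull a b d = solve 4 (λ a b s d → a :* (b :* (s :* d)) := s :* (a :* (b :* d))) refl a b s d

  ∘-scales : ∀ n σ τ s t → ScalesDet n σ s → ScalesDet n τ t → ScalesDet n (λ i → σ (τ i)) (t * s)
  ∘-scales n σ τ s t σ-scales τ-scales M =
    trans (τ-scales (λ i j → M (σ i) j)) (trans (*-congˡ (σ-scales M)) (sym (*-assoc t s _)))

  moveTop : ∀ {n} → Fin (suc n) → Fin (suc n) → Fin (suc n)
  moveTop c F.zero    = c
  moveTop c (F.suc i) = punchIn c i

  -- Moving row c to the top is c adjacent transpositions.
  moveTop-scales : ∀ n (c : Fin (suc n)) → ScalesDet (suc n) (moveTop c) (signPow (toℕ c))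
  moveTop-scales n F.zero M = trans (det-cong (suc n) same) (sym (*-identityˡ _))
    where
    same : ∀ i j → M (moveTop F.zero i) j ≈ M i j
    same F.zero    j = refl
    same (F.suc i) j = refl
  moveTop-scales (suc n) (F.suc c) M = trans (det-cong (suc (suc n)) factor)
    (∘-scales (suc (suc n)) (lift (moveTop c)) swap01 _ _
       (lift-scales (suc n) (moveTop c) _ (moveTop-scales n c)) (swap01-scales n) M)
    where
    factor : ∀ i j → M (moveTop (F.suc c) i) j ≈ M (lift (moveTop c) (swap01 i)) j
    factor F.zero            j = refl
    factor (F.suc F.zero)    j = refl
    factor (F.suc (F.suc i)) j = refl

  det-expandRow : ∀ n (M : Matrix (suc n)) (t : Fin (suc n)) →
    det (suc n) M ≈ signPow (toℕ t) * laplace n (M t) (λ i → M (punchIn t i))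
  det-expandRow n M t = trans (sym (signPow-cancel (toℕ t) _)) (*-congˡ (sym (moveTop-scales n t M)))

  det-singleEntryRow : ∀ n (M : Matrix (suc n)) (t d : Fin (suc n)) → (∀ j → j ≢ d → M t j ≈ 0#) →
    det (suc n) M ≈ signPow (toℕ t) * (signPow (toℕ d) * (M t d * det n (λ i k → M (punchIn t i) (punchIn d k))))
  det-singleEntryRow n M t d h = trans (det-expandRow n M t) (*-congˡ (sumFin-single (suc n) (laplaceTerm n (M t) (λ i → M (punchIn t i))) d
    (λ j j≢d → trans (*-congˡ (trans (*-congʳ (h j j≢d)) (zeroˡ _))) (zeroʳ _))))

  det-zeroRow : ∀ n (M : Matrix n) (t : Fin n) → (∀ j → M t j ≈ 0#) → det n M ≈ 0#
  det-zeroRow (suc n) M t h = trans (det-expandRow n M t) (trans (*-congˡ (sumFin-0 (suc n) (laplaceTerm n (M t) (λ i → M (punchIn t i)))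
    (λ j → trans (*-congˡ (trans (*-congʳ (h j)) (zeroˡ _))) (zeroʳ _)))) (zeroʳ _))

  -- A matrix with two equal rows has determinant 0: move one of them to the
  -- top and the other just below it.
  det-equalRows : ∀ n (M : Matrix n) (p t : Fin n) → p ≢ t → (∀ j → M p j ≈ M t j) → det n M ≈ 0#
  det-equalRows (suc zero)    M F.zero F.zero p≢t _ = ⊥-elim (p≢t ≡.refl)
  det-equalRows (suc (suc n)) M p t p≢t h = begin
    det (suc (suc n)) M                          ≈⟨ det-expandRow (suc n) M t ⟩
    signPow (toℕ t) * det (suc (suc n)) N        ≈⟨ *-congˡ (sym (signPow-cancel (toℕ q) _)) ⟩
    signPow (toℕ t) * (signPow (toℕ q) * (signPow (toℕ q) * det (suc (suc n)) N))
      ≈⟨ *-congˡ (*-congˡ (sym (lift-scales (suc n) (moveTop q) _ (moveTop-scales n q) N))) ⟩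
    signPow (toℕ t) * (signPow (toℕ q) * det (suc (suc n)) (λ i j → N (lift (moveTop q) i) j))
      ≈⟨ *-congˡ (*-congˡ (det-rows01-equal n (λ i j → N (lift (moveTop q) i) j) (λ j → trans (sym (h j)) (reflexive (≡.cong (λ k → M k j) p≡))))) ⟩
    signPow (toℕ t) * (signPow (toℕ q) * 0#)     ≈⟨ trans (*-congˡ (zeroʳ _)) (zeroʳ _) ⟩
    0#                                           ∎
    where
    -- N is M with row t moved to the top; row p of M is row q+1 of N.
    N : Matrix (suc (suc n))
    N = consRow (M t) (λ i → M (punchIn t i))
    t≢p : t ≢ p
    t≢p e = p≢t (≡.sym e)
    q = punchOut t≢p
    p≡ : p ≡ punchIn t q
    p≡ = ≡.sym (FP.punchIn-punchOut t≢p)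

  setRow : ∀ {n} → Matrix n → Fin n → (Fin n → Carrier) → Matrix n
  setRow M t v i j with i F.≟ t
  ... | yes _ = v j
  ... | no  _ = M i j

  setRow-here : ∀ {n} (M : Matrix n) t v j → setRow M t v t j ≈ v j
  setRow-here M t v j with t F.≟ t
  ... | yes _  = refl
  ... | no t≢t = ⊥-elim (t≢t ≡.refl)

  setRow-there : ∀ {n} (M : Matrix n) t v i j → i ≢ t → setRow M t v i j ≈ M i j
  setRow-there M t v i j i≢t with i F.≟ t
  ... | yes i≡t = ⊥-elim (i≢t i≡t)
  ... | no  _   = refl

  det-rowLinear : ∀ n (M : Matrix n) (t : Fin n) (u v : Fin n → Carrier) x → (∀ j → M t j ≈ u j + x * v j) →
    det n M ≈ det n (setRow M t u) + x * det n (setRow M t v)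
  det-rowLinear (suc n) M t u v x h = begin
    det (suc n) M                            ≈⟨ det-expandRow n M t ⟩
    s * laplace n (M t) rows                 ≈⟨ *-congˡ (laplace-cong n {rows = rows} {rows′ = rows} h (λ i j → refl)) ⟩
    s * laplace n (λ j → u j + x * v j) rows ≈⟨ *-congˡ (laplace-linear n u v x rows) ⟩
    s * (laplace n u rows + x * laplace n v rows)
      ≈⟨ trans (distribˡ s _ _) (+-congˡ (solve 3 (λ s x d → s :* (x :* d) := x :* (s :* d)) refl s x _)) ⟩
    s * laplace n u rows + x * (s * laplace n v rows)
      ≈⟨ sym (+-cong (expandSet u) (*-congˡ (expandSet v))) ⟩
    det (suc n) (setRow M t u) + x * det (suc n) (setRow M t v) ∎
    where
    s = signPow (toℕ t)
    rows : Fin n → Fin (suc n) → Carrier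
    rows i = M (punchIn t i)
    expandSet : ∀ w → det (suc n) (setRow M t w) ≈ s * laplace n w rows
    expandSet w = trans (det-expandRow n (setRow M t w) t)
      (*-congˡ (laplace-cong n (setRow-here M t w) (λ i j → setRow-there M t w _ j (FP.punchInᵢ≢i t i))))

  det-rowOp : ∀ n (M M′ : Matrix n) (p t : Fin n) x → p ≢ t →
    (∀ j → M′ t j ≈ M t j + x * M p j) → (∀ i j → i ≢ t → M′ i j ≈ M i j) → det n M′ ≈ det n M
  det-rowOp n M M′ p t x p≢t ht hr = begin
    det n M′                                                   ≈⟨ det-rowLinear n M′ t (M t) (M p) x ht ⟩
    det n (setRow M′ t (M t)) + x * det n (setRow M′ t (M p))  ≈⟨ +-cong (det-cong n restored) (*-congˡ twoEqualRows) ⟩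
    det n M + x * 0#                                           ≈⟨ trans (+-congˡ (zeroʳ x)) (+-identityʳ _) ⟩
    det n M                                                    ∎
    where
    restored : ∀ i j → setRow M′ t (M t) i j ≈ M i j
    restored i j with i F.≟ t
    ... | yes ≡.refl = refl
    ... | no  i≢t    = hr i j i≢t
    twoEqualRows : det n (setRow M′ t (M p)) ≈ 0#
    twoEqualRows = det-equalRows n _ p t p≢t
      (λ j → trans (setRow-there M′ t _ p j p≢t) (trans (hr p j p≢t) (sym (setRow-here M′ t _ j))))

module Corners {c ℓ : Level} (R : CommutativeRing c ℓ) where
  open CommutativeRing R
  open Ops R
  open Determinants R
  open SetoidReasoning setoid

  ℕMatrix : Set c
  ℕMatrix = ℕ → ℕ → Carrier

  corner : ∀ N → ℕMatrix → Matrix N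
  corner N A i j = A (toℕ i) (toℕ j)

  det-corner-cong : ∀ N (A A′ : ℕMatrix) → (∀ i j → i ℕ.< N → j ℕ.< N → A i j ≈ A′ i j) →
    det N (corner N A) ≈ det N (corner N A′)
  det-corner-cong N A A′ e = det-cong N (λ i j → e (toℕ i) (toℕ j) (FP.toℕ<n i) (FP.toℕ<n j))

  det-corner-resize : ∀ {N N′} (A : ℕMatrix) → N ≡ N′ → det N (corner N A) ≈ det N′ (corner N′ A)
  det-corner-resize A ≡.refl = refl

  det-rowOpℕ : ∀ N (A A′ : ℕMatrix) p t x → p ℕ.< N → t ℕ.< N → p ≢ t →
    (∀ j → A′ t j ≈ A t j + x * A p j) → (∀ i j → i ≢ t → A′ i j ≈ A i j) →
    det N (corner N A′) ≈ det N (corner N A)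
  det-rowOpℕ N A A′ p t x p<N t<N p≢t ht hr =
    det-rowOp N (corner N A) (corner N A′) p′ t′ x p′≢t′ ht′ hr′
    where
    p′ = F.fromℕ< p<N
    t′ = F.fromℕ< t<N
    p′≢t′ : p′ ≢ t′
    p′≢t′ e = p≢t (≡.trans (≡.sym (FP.toℕ-fromℕ< p<N)) (≡.trans (≡.cong toℕ e) (FP.toℕ-fromℕ< t<N)))
    ht′ : ∀ j → corner N A′ t′ j ≈ corner N A t′ j + x * corner N A p′ j
    ht′ j rewrite FP.toℕ-fromℕ< t<N | FP.toℕ-fromℕ< p<N = ht (toℕ j)
    hr′ : ∀ i j → i ≢ t′ → corner N A′ i j ≈ corner N A i j
    hr′ i j i≢t′ = hr (toℕ i) (toℕ j) (λ e → i≢t′ (FP.toℕ-injective (≡.trans e (≡.sym (FP.toℕ-fromℕ< t<N)))))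

  deleteColumn : ℕ → ℕMatrix → ℕMatrix
  deleteColumn d A i j with j ℕ.<? d
  ... | yes _ = A i j
  ... | no  _ = A i (suc j)

  deleteColumn-< : ∀ d A i j → j ℕ.< d → deleteColumn d A i j ≈ A i j
  deleteColumn-< d A i j j<d with j ℕ.<? d
  ... | yes _   = refl
  ... | no  j≮d = ⊥-elim (j≮d j<d)

  deleteColumn-≥ : ∀ d A i j → ¬ (j ℕ.< d) → deleteColumn d A i j ≈ A i (suc j)
  deleteColumn-≥ d A i j j≮d with j ℕ.<? d
  ... | yes j<d = ⊥-elim (j≮d j<d)
  ... | no  _   = refl

  toℕ-punchIn-< : ∀ {n} (c : Fin (suc n)) (j : Fin n) → toℕ j ℕ.< toℕ c → toℕ (punchIn c j) ≡ toℕ j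
  toℕ-punchIn-< (F.suc c) F.zero    _         = ≡.refl
  toℕ-punchIn-< (F.suc c) (F.suc j) (s≤s j<c) = ≡.cong suc (toℕ-punchIn-< c j j<c)

  toℕ-punchIn-≥ : ∀ {n} (c : Fin (suc n)) (j : Fin n) → toℕ c ℕ.≤ toℕ j → toℕ (punchIn c j) ≡ suc (toℕ j)
  toℕ-punchIn-≥ F.zero    j         _         = ≡.refl
  toℕ-punchIn-≥ (F.suc c) (F.suc j) (s≤s c≤j) = ≡.cong suc (toℕ-punchIn-≥ c j c≤j)

  det-lastRowSingle : ∀ n (A : ℕMatrix) d → d ℕ.≤ n → (∀ j → j ℕ.≤ n → j ≢ d → A n j ≈ 0#) →
    det (suc n) (corner (suc n) A) ≈ signPow n * (signPow d * (A n d * det n (corner n (deleteColumn d A))))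
  det-lastRowSingle n A d d≤n single = begin
    det (suc n) (corner (suc n) A)
      ≈⟨ det-singleEntryRow n (corner (suc n) A) last d′ singleFin ⟩
    signPow (toℕ last) * (signPow (toℕ d′) * (corner (suc n) A last d′ * D))
      ≡⟨ ≡.cong₂ (λ a e → signPow a * (signPow e * (A a e * D))) (FP.toℕ-fromℕ n) (FP.toℕ-fromℕ< (s≤s d≤n)) ⟩
    signPow n * (signPow d * (A n d * D))
      ≈⟨ *-congˡ (*-congˡ (*-congˡ (det-cong n minor))) ⟩
    signPow n * (signPow d * (A n d * det n (corner n (deleteColumn d A)))) ∎
    where
    last d′ : Fin (suc n)
    last = F.fromℕ n
    d′ = F.fromℕ< (s≤s d≤n)
    D : Carrier
    D = det n (λ i k → corner (suc n) A (punchIn last i) (punchIn d′ k))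
    singleFin : ∀ j → j ≢ d′ → corner (suc n) A last j ≈ 0#
    singleFin j j≢d′ rewrite FP.toℕ-fromℕ n =
      single (toℕ j) (ℕP.≤-pred (FP.toℕ<n j)) (λ e → j≢d′ (FP.toℕ-injective (≡.trans e (≡.sym (FP.toℕ-fromℕ< (s≤s d≤n))))))
    minor : ∀ i k → corner (suc n) A (punchIn last i) (punchIn d′ k) ≈ deleteColumn d A (toℕ i) (toℕ k)
    minor i k rewrite toℕ-punchIn-< last i (≡.subst (toℕ i ℕ.<_) (≡.sym (FP.toℕ-fromℕ n)) (FP.toℕ<n i)) with toℕ k ℕ.<? d
    ... | yes k<d = reflexive (≡.cong (A (toℕ i)) (toℕ-punchIn-< d′ k (≡.subst (toℕ k ℕ.<_) (≡.sym (FP.toℕ-fromℕ< (s≤s d≤n))) k<d)))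
    ... | no  k≮d = reflexive (≡.cong (A (toℕ i)) (toℕ-punchIn-≥ d′ k (≡.subst (ℕ._≤ toℕ k) (≡.sym (FP.toℕ-fromℕ< (s≤s d≤n))) (ℕP.≮⇒≥ k≮d))))

module Elimination {c ℓ : Level} (R : CommutativeRing c ℓ) where
  open CommutativeRing R
  open Ops R
  open FiniteSums R
  open Corners R
  open SetoidReasoning setoid

  replaceRow : ℕMatrix → ℕ → (ℕ → Carrier) → ℕMatrix
  replaceRow A t v i j with i ℕ.≟ t
  ... | yes _ = v j
  ... | no  _ = A i j

  replaceRow-here : ∀ A t v j → replaceRow A t v t j ≈ v j
  replaceRow-here A t v j with t ℕ.≟ t
  ... | yes _  = refl
  ... | no t≢t = ⊥-elim (t≢t ≡.refl)

  replaceRow-there : ∀ A t v i j → i ≢ t → replaceRow A t v i j ≈ A i j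
  replaceRow-there A t v i j i≢t with i ℕ.≟ t
  ... | yes i≡t = ⊥-elim (i≢t i≡t)
  ... | no  _   = refl

  det-addCombination : ∀ N (A A′ : ℕMatrix) t (coeff : ℕ → Carrier) p → t ℕ.< N → p ℕ.≤ t →
    (∀ j → A′ t j ≈ A t j + Σ p (λ k → coeff k * A k j)) → (∀ i j → i ≢ t → A′ i j ≈ A i j) →
    det N (corner N A′) ≈ det N (corner N A)
  det-addCombination N A A′ t coeff zero t<N _ ht hr = det-corner-cong N A′ A same
    where
    same : ∀ i j → i ℕ.< N → j ℕ.< N → A′ i j ≈ A i j
    same i j _ _ with i ℕ.≟ t
    ... | yes ≡.refl = trans (ht j) (+-identityʳ _)
    ... | no  i≢t    = hr i j i≢t
  det-addCombination N A A′ t coeff (suc p) t<N p<t ht hr = begin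
    det N (corner N A′) ≈⟨ det-rowOpℕ N A″ A′ p t (coeff p) (ℕP.<-trans p<t t<N) t<N (ℕP.<⇒≢ p<t) ht′ hr′ ⟩
    det N (corner N A″) ≈⟨ det-addCombination N A A″ t coeff p t<N (ℕP.<⇒≤ p<t)
                             (replaceRow-here A t _) (λ i j → replaceRow-there A t _ i j) ⟩
    det N (corner N A)  ∎
    where
    A″ : ℕMatrix
    A″ = replaceRow A t (λ j → A t j + Σ p (λ k → coeff k * A k j))
    ht′ : ∀ j → A′ t j ≈ A″ t j + coeff p * A″ p j
    ht′ j = begin
      A′ t j                                                        ≈⟨ ht j ⟩
      A t j + Σ (suc p) (λ k → coeff k * A k j)                        ≈⟨ +-congˡ (Σ-last p (λ k → coeff k * A k j)) ⟩
      A t j + (Σ p (λ k → coeff k * A k j) + coeff p * A p j)             ≈⟨ sym (+-assoc _ _ _) ⟩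
      (A t j + Σ p (λ k → coeff k * A k j)) + coeff p * A p j             ≈⟨ sym (+-cong (replaceRow-here A t _ j)
                                                                          (*-congˡ (replaceRow-there A t _ p j (ℕP.<⇒≢ p<t)))) ⟩
      A″ t j + coeff p * A″ p j                                        ∎
    hr′ : ∀ i j → i ≢ t → A′ i j ≈ A″ i j
    hr′ i j i≢t = trans (hr i j i≢t) (sym (replaceRow-there A t _ i j i≢t))

  eliminated : (H U : ℕMatrix) → ℕ → ℕMatrix
  eliminated H U t i j with i ℕ.<? t
  ... | yes _ = U i j
  ... | no  _ = H i j

  eliminated-< : ∀ H U t i j → i ℕ.< t → eliminated H U t i j ≈ U i j
  eliminated-< H U t i j i<t with i ℕ.<? t
  ... | yes _   = refl
  ... | no  i≮t = ⊥-elim (i≮t i<t)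

  eliminated-≥ : ∀ H U t i j → ¬ (i ℕ.< t) → eliminated H U t i j ≈ H i j
  eliminated-≥ H U t i j i≮t with i ℕ.<? t
  ... | yes i<t = ⊥-elim (i≮t i<t)
  ... | no  _   = refl

  eliminated-step : ∀ H U t i j → i ≢ t → eliminated H U t i j ≈ eliminated H U (suc t) i j
  eliminated-step H U t i j i≢t = byCases (i ℕ.<? t)
    where
    byCases : Dec (i ℕ.< t) → eliminated H U t i j ≈ eliminated H U (suc t) i j
    byCases (yes i<t) = trans (eliminated-< H U t i j i<t)
                              (sym (eliminated-< H U (suc t) i j (ℕP.<-trans i<t (ℕP.n<1+n t))))
    byCases (no  i≮t) = trans (eliminated-≥ H U t i j i≮t)
                              (sym (eliminated-≥ H U (suc t) i j (λ i<1+t → i≮t (ℕP.≤∧≢⇒< (ℕP.≤-pred i<1+t) i≢t))))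

  -- Eliminating the rows top-down turns H into U.
  det-unitriangular : ∀ N (H U L : ℕMatrix) →
    (∀ i j → i ℕ.< N → H i j ≈ U i j + Σ i (λ k → L i k * U k j)) →
    det N (corner N H) ≈ det N (corner N U)
  det-unitriangular N H U L factor = begin
    det N (corner N H)                  ≈⟨ det-corner-cong N H (E 0) (λ i j _ _ → sym (eliminated-≥ H U 0 i j (λ ()))) ⟩
    det N (corner N (E 0))              ≈⟨ eliminate N ℕP.≤-refl ⟩
    det N (corner N (E N))              ≈⟨ det-corner-cong N (E N) U (λ i j i<N _ → eliminated-< H U N i j i<N) ⟩
    det N (corner N U)                  ∎
    where
    E : ℕ → ℕMatrix
    E = eliminated H U
    step : ∀ t → t ℕ.< N → det N (corner N (E t)) ≈ det N (corner N (E (suc t)))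
    step t t<N = det-addCombination N (E (suc t)) (E t) t (L t) t t<N ℕP.≤-refl rowT (λ i j → eliminated-step H U t i j)
      where
      rowT : ∀ j → E t t j ≈ E (suc t) t j + Σ t (λ k → L t k * E (suc t) k j)
      rowT j = begin
        E t t j                                 ≈⟨ eliminated-≥ H U t t j (ℕP.<-irrefl ≡.refl) ⟩
        H t j                                   ≈⟨ factor t j t<N ⟩
        U t j + Σ t (λ k → L t k * U k j)       ≈⟨ sym (+-cong (eliminated-< H U (suc t) t j (ℕP.n<1+n t))
                                                     (Σ-cong t {λ k → L t k * E (suc t) k j} {λ k → L t k * U k j} (λ k k<t → *-congˡ (eliminated-< H U (suc t) k j (ℕP.<-trans k<t (ℕP.n<1+n t)))))) ⟩
        E (suc t) t j + Σ t (λ k → L t k * E (suc t) k j) ∎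
    eliminate : ∀ t → t ℕ.≤ N → det N (corner N (E 0)) ≈ det N (corner N (E t))
    eliminate zero    _   = refl
    eliminate (suc t) t<N = trans (eliminate t (ℕP.<⇒≤ t<N)) (step t t<N)

module PowerSeriesAlgebra {c ℓ : Level} (R : CommutativeRing c ℓ) where
  open CommutativeRing R
  open Ops R
  open FiniteSums R
  open SetoidReasoning setoid

  mulZ : PowerSeries → PowerSeries
  mulZ P zero    = 0#
  mulZ P (suc n) = P n

  mulZ^ : ℕ → PowerSeries → PowerSeries
  mulZ^ zero    P = P
  mulZ^ (suc k) P = mulZ (mulZ^ k P)

  ·-cong : ∀ {P P′ Q Q′} → P ≋ P′ → Q ≋ Q′ → (P · Q) ≋ (P′ · Q′)
  ·-cong {P} {P′} {Q} {Q′} eP eQ n =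
    Σ-cong (suc n) {λ i → P i * Q (n ℕ.∸ i)} {λ i → P′ i * Q′ (n ℕ.∸ i)} (λ i _ → *-cong (eP i) (eQ (n ℕ.∸ i)))

  ·-distribˡ : ∀ P Q T → (P · (Q ⊕ T)) ≋ ((P · Q) ⊕ (P · T))
  ·-distribˡ P Q T n = trans
    (Σ-cong (suc n) {λ i → P i * (Q (n ℕ.∸ i) + T (n ℕ.∸ i))} {λ i → P i * Q (n ℕ.∸ i) + P i * T (n ℕ.∸ i)}
      (λ i _ → distribˡ _ _ _))
    (Σ-+ (suc n) (λ i → P i * Q (n ℕ.∸ i)) (λ i → P i * T (n ℕ.∸ i)))

  ·-distribʳ : ∀ P Q T → ((P ⊕ Q) · T) ≋ ((P · T) ⊕ (Q · T))
  ·-distribʳ P Q T n = trans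
    (Σ-cong (suc n) {λ i → (P i + Q i) * T (n ℕ.∸ i)} {λ i → P i * T (n ℕ.∸ i) + Q i * T (n ℕ.∸ i)}
      (λ i _ → distribʳ _ _ _))
    (Σ-+ (suc n) (λ i → P i * T (n ℕ.∸ i)) (λ i → Q i * T (n ℕ.∸ i)))

  ·-scaleˡ : ∀ x P Q → (scale x P · Q) ≋ scale x (P · Q)
  ·-scaleˡ x P Q n = trans
    (Σ-cong (suc n) {λ i → (x * P i) * Q (n ℕ.∸ i)} {λ i → x * (P i * Q (n ℕ.∸ i))} (λ i _ → *-assoc _ _ _))
    (Σ-*ˡ (suc n) x (λ i → P i * Q (n ℕ.∸ i)))

  ·-scaleʳ : ∀ x P Q → (P · scale x Q) ≋ scale x (P · Q)
  ·-scaleʳ x P Q n = trans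
    (Σ-cong (suc n) {λ i → P i * (x * Q (n ℕ.∸ i))} {λ i → x * (P i * Q (n ℕ.∸ i))}
      (λ i _ → trans (sym (*-assoc _ _ _)) (trans (*-congʳ (*-comm _ _)) (*-assoc _ _ _))))
    (Σ-*ˡ (suc n) x (λ i → P i * Q (n ℕ.∸ i)))

  ·-oneˡ : ∀ P → (one · P) ≋ P
  ·-oneˡ P n = trans (+-cong (*-identityˡ _) (Σ-0 n (λ i → 0# * P (n ℕ.∸ suc i)) (λ i _ → zeroˡ _))) (+-identityʳ _)

  ·-oneʳ : ∀ P → (P · one) ≋ P
  ·-oneʳ P n = begin
    Σ (suc n) (λ i → P i * one (n ℕ.∸ i))                        ≈⟨ Σ-last n (λ i → P i * one (n ℕ.∸ i)) ⟩
    Σ n (λ i → P i * one (n ℕ.∸ i)) + P n * one (n ℕ.∸ n)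
      ≈⟨ +-cong (Σ-0 n (λ i → P i * one (n ℕ.∸ i)) (λ i i<n → trans (*-congˡ (one-positive i n i<n)) (zeroʳ _)))
                (*-congˡ (reflexive (≡.cong one (ℕP.n∸n≡0 n)))) ⟩
    0# + P n * 1#                                                ≈⟨ trans (+-identityˡ _) (*-identityʳ _) ⟩
    P n                                                          ∎
    where
    one-positive : ∀ i n → i ℕ.< n → one (n ℕ.∸ i) ≈ 0#
    one-positive zero    (suc n) _         = refl
    one-positive (suc i) (suc n) (s≤s i<n) = one-positive i n i<n

  mulZ-cong : ∀ {P Q} → P ≋ Q → mulZ P ≋ mulZ Q
  mulZ-cong e zero    = refl
  mulZ-cong e (suc n) = e n

  ·-mulZˡ : ∀ P Q → (mulZ P · Q) ≋ mulZ (P · Q)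
  ·-mulZˡ P Q zero    = trans (+-identityʳ _) (zeroˡ _)
  ·-mulZˡ P Q (suc n) = trans (+-congʳ (zeroˡ _)) (+-identityˡ _)

  ·-mulZʳ : ∀ P Q → (P · mulZ Q) ≋ mulZ (P · Q)
  ·-mulZʳ P Q zero    = trans (+-identityʳ _) (zeroʳ _)
  ·-mulZʳ P Q (suc n) = begin
    Σ (suc (suc n)) (λ i → P i * mulZ Q (suc n ℕ.∸ i))
      ≈⟨ Σ-last (suc n) (λ i → P i * mulZ Q (suc n ℕ.∸ i)) ⟩
    Σ (suc n) (λ i → P i * mulZ Q (suc n ℕ.∸ i)) + P (suc n) * mulZ Q (suc n ℕ.∸ suc n)
      ≈⟨ +-cong (Σ-cong (suc n) {λ i → P i * mulZ Q (suc n ℕ.∸ i)} {λ i → P i * Q (n ℕ.∸ i)}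
                  (λ i i≤n → *-congˡ (reflexive (≡.cong (mulZ Q) (ℕP.+-∸-assoc 1 (ℕP.≤-pred i≤n))))))
                (trans (*-congˡ (reflexive (≡.cong (mulZ Q) (ℕP.n∸n≡0 n)))) (zeroʳ _)) ⟩
    Σ (suc n) (λ i → P i * Q (n ℕ.∸ i)) + 0#                      ≈⟨ +-identityʳ _ ⟩
    Σ (suc n) (λ i → P i * Q (n ℕ.∸ i))                           ∎

  mulZ^-below : ∀ k P n → n ℕ.< k → mulZ^ k P n ≈ 0#
  mulZ^-below (suc k) P zero    _         = refl
  mulZ^-below (suc k) P (suc n) (s≤s n<k) = mulZ^-below k P n n<k

  mulZ^-shifted : ∀ k P t → mulZ^ k P (k ℕ.+ t) ≈ P t
  mulZ^-shifted zero    P t = refl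
  mulZ^-shifted (suc k) P t = mulZ^-shifted k P t

  mulZ^-cong : ∀ k {P Q} → P ≋ Q → mulZ^ k P ≋ mulZ^ k Q
  mulZ^-cong zero    e = e
  mulZ^-cong (suc k) e = mulZ-cong (mulZ^-cong k e)

  mulZ^-⊕ : ∀ k P Q → mulZ^ k (P ⊕ Q) ≋ (mulZ^ k P ⊕ mulZ^ k Q)
  mulZ^-⊕ zero    P Q n       = refl
  mulZ^-⊕ (suc k) P Q zero    = sym (+-identityˡ 0#)
  mulZ^-⊕ (suc k) P Q (suc n) = mulZ^-⊕ k P Q n

  mulZ^-scale : ∀ k x P → mulZ^ k (scale x P) ≋ scale x (mulZ^ k P)
  mulZ^-scale zero    x P n       = refl
  mulZ^-scale (suc k) x P zero    = sym (zeroʳ x)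
  mulZ^-scale (suc k) x P (suc n) = mulZ^-scale k x P n

  mulZ^-mulZ : ∀ k P → mulZ^ k (mulZ P) ≋ mulZ^ (suc k) P
  mulZ^-mulZ zero    P n = refl
  mulZ^-mulZ (suc k) P   = mulZ-cong (mulZ^-mulZ k P)

-- Its square S = F² satisfies
-- S = 1 + 2bzS + b²z²S², so the table B(n,k) = [zⁿ] z^k S^(k+1) satisfies
-- B(n+1,·) = J B(n,·) for the tridiagonal operator
-- (J v)(k) = v(k-1) + 2b v(k) + b² v(k+1), which is self-adjoint for the
-- weights b^(2k+1).  This gives the orthogonality relation
-- Σ_k B(i,k) B(j,k) b^(2k+1) = b S(i+j).
module CatalanTable {c ℓ : Level} (R : CommutativeRing c ℓ)
  (b : CommutativeRing.Carrier R) (F : Ops.PowerSeries R)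
  (F-equation : Ops._≋_ R F (Ops._⊕_ R (Ops.one R) (Ops.scale R b (PowerSeriesAlgebra.mulZ R (Ops._·_ R F F))))) where
  open CommutativeRing R
  open Ops R
  open FiniteSums R
  open PowerSeriesAlgebra R
  open Powers R using (pow-square)
  open RingSolver commutativeSemiring using (solve; _:=_; _:+_; _:*_)
  open SetoidReasoning setoid

  S : PowerSeries
  S = F · F

  β δ : Carrier
  β = b + b
  δ = b * b

  -- S = (1 + bzS)² = 1 + 2bzS + b²z²S²; write β = 2b and δ = b².
  S-equation : S ≋ (one ⊕ (scale β (mulZ S) ⊕ scale δ (mulZ (mulZ (S · S)))))
  S-equation n = begin
    S n                                           ≈⟨ ·-cong F-equation F-equation n ⟩
    ((one ⊕ T) · (one ⊕ T)) n                     ≈⟨ ·-distribʳ one T (one ⊕ T) n ⟩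
    (one · (one ⊕ T)) n + (T · (one ⊕ T)) n       ≈⟨ +-cong (·-oneˡ (one ⊕ T) n) (·-distribˡ T one T n) ⟩
    (one n + T n) + ((T · one) n + (T · T) n)     ≈⟨ +-congˡ (+-cong (·-oneʳ T n) T²) ⟩
    (one n + b * mulZ S n) + (b * mulZ S n + b * (b * mulZ (mulZ (S · S)) n))
      ≈⟨ collect (one n) (mulZ S n) (mulZ (mulZ (S · S)) n) ⟩
    one n + (β * mulZ S n + δ * mulZ (mulZ (S · S)) n) ∎
    where
    T : PowerSeries
    T = scale b (mulZ S)
    T² : (T · T) n ≈ b * (b * mulZ (mulZ (S · S)) n)
    T² = begin
      (T · T) n                        ≈⟨ ·-scaleˡ b (mulZ S) T n ⟩
      b * (mulZ S · T) n               ≈⟨ *-congˡ (·-scaleʳ b (mulZ S) (mulZ S) n) ⟩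
      b * (b * (mulZ S · mulZ S) n)    ≈⟨ *-congˡ (*-congˡ (trans (·-mulZˡ S (mulZ S) n) (mulZ-cong (·-mulZʳ S S) n))) ⟩
      b * (b * mulZ (mulZ (S · S)) n)  ∎
    collect : ∀ o x y → (o + b * x) + (b * x + b * (b * y)) ≈ o + (β * x + δ * y)
    collect o x y = solve 4 (λ o b x y → (o :+ b :* x) :+ (b :* x :+ b :* (b :* y)) := o :+ ((b :+ b) :* x :+ (b :* b) :* y)) refl o b x y

  S^ : ℕ → PowerSeries
  S^ zero    = one
  S^ (suc k) = S · S^ k

  S^-recurrence : ∀ k → S^ (suc k) ≋ (S^ k ⊕ (scale β (mulZ (S^ (suc k))) ⊕ scale δ (mulZ (mulZ (S^ (suc (suc k)))))))
  S^-recurrence zero n = trans (·-oneʳ S n) (trans (S-equation n)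
    (+-congˡ (+-cong (*-congˡ (mulZ-cong (λ p → sym (·-oneʳ S p)) n))
                     (*-congˡ (mulZ-cong (mulZ-cong (·-cong {S} {S} {S} {S^ 1} (λ p → refl) (λ p → sym (·-oneʳ S p)))) n)))))
  S^-recurrence (suc k) n = begin
    (S · S^ (suc k)) n                   ≈⟨ ·-cong {S} {S} {S^ (suc k)} {S^ k ⊕ (A₁ ⊕ A₂)} (λ p → refl) (S^-recurrence k) n ⟩
    (S · (S^ k ⊕ (A₁ ⊕ A₂))) n           ≈⟨ trans (·-distribˡ S (S^ k) (A₁ ⊕ A₂) n) (+-congˡ (·-distribˡ S A₁ A₂ n)) ⟩
    (S · S^ k) n + ((S · A₁) n + (S · A₂) n)
      ≈⟨ +-congˡ (+-cong (trans (·-scaleʳ β S (mulZ (S^ (suc k))) n) (*-congˡ (·-mulZʳ S (S^ (suc k)) n)))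
                         (trans (·-scaleʳ δ S (mulZ (mulZ (S^ (suc (suc k))))) n)
                            (*-congˡ (trans (·-mulZʳ S (mulZ (S^ (suc (suc k)))) n) (mulZ-cong (·-mulZʳ S (S^ (suc (suc k)))) n))))) ⟩
    (S · S^ k) n + (β * mulZ (S · S^ (suc k)) n + δ * mulZ (mulZ (S · S^ (suc (suc k)))) n) ∎
    where
    A₁ = scale β (mulZ (S^ (suc k)))
    A₂ = scale δ (mulZ (mulZ (S^ (suc (suc k)))))

  B : ℕ → ℕ → Carrier
  B n k = mulZ^ k (S^ (suc k)) n

  jacobi : (ℕ → Carrier) → ℕ → Carrier
  jacobi v k = mulZ v k + (β * v k + δ * v (suc k))

  B-recurrence : ∀ n k → B (suc n) k ≈ jacobi (B n) k
  B-recurrence n k = begin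
    mulZ^ k (S^ (suc k)) (suc n)
      ≈⟨ trans (mulZ^-cong k (S^-recurrence k) (suc n)) (mulZ^-⊕ k _ _ (suc n)) ⟩
    mulZ^ k (S^ k) (suc n) + mulZ^ k (scale β (mulZ (S^ (suc k))) ⊕ scale δ (mulZ (mulZ (S^ (suc (suc k)))))) (suc n)
      ≈⟨ +-cong (previousColumn k) (mulZ^-⊕ k _ _ (suc n)) ⟩
    mulZ (B n) k + (mulZ^ k (scale β (mulZ (S^ (suc k)))) (suc n) + mulZ^ k (scale δ (mulZ (mulZ (S^ (suc (suc k)))))) (suc n))
      ≈⟨ +-congˡ (+-cong (trans (mulZ^-scale k _ _ (suc n)) (*-congˡ (mulZ^-mulZ k _ (suc n))))
                         (trans (mulZ^-scale k _ _ (suc n)) (*-congˡ (trans (mulZ^-mulZ k _ (suc n)) (mulZ^-mulZ k _ n))))) ⟩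
    jacobi (B n) k ∎
    where
    previousColumn : ∀ k → mulZ^ k (S^ k) (suc n) ≈ mulZ (B n) k
    previousColumn zero    = refl
    previousColumn (suc k) = refl

  B-below : ∀ n k → n ℕ.< k → B n k ≈ 0#
  B-below n k n<k = mulZ^-below k _ n n<k

  B-diagonal : ∀ n → B n n ≈ 1#
  B-diagonal n = trans (reflexive (≡.cong (mulZ^ n (S^ (suc n))) (≡.sym (ℕP.+-identityʳ n))))
                       (trans (mulZ^-shifted n _ 0) (S^-constant (suc n)))
    where
    F₀ : F 0 ≈ 1#
    F₀ = trans (F-equation 0) (trans (+-congˡ (zeroʳ b)) (+-identityʳ 1#))
    S^-constant : ∀ k → S^ k 0 ≈ 1#
    S^-constant zero    = refl
    S^-constant (suc k) = trans (+-identityʳ _) (trans (*-cong (trans (+-identityʳ _) (trans (*-cong F₀ F₀) (*-identityˡ 1#))) (S^-constant k)) (*-identityˡ 1#))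

  B-column0 : ∀ n → B n 0 ≈ S n
  B-column0 = ·-oneʳ S

  weight : ℕ → Carrier
  weight k = b * pow δ k

  weight-as-pow : ∀ k → weight k ≈ pow b (suc (k ℕ.+ k))
  weight-as-pow k = *-congˡ (pow-square b k)

  form : ℕ → (ℕ → Carrier) → (ℕ → Carrier) → Carrier
  form K v w = Σ K (λ k → v k * (w k * weight k))

  form-cong : ∀ K {v v′ w w′ : ℕ → Carrier} → (∀ k → v k ≈ v′ k) → (∀ k → w k ≈ w′ k) → form K v w ≈ form K v′ w′
  form-cong K {v} {v′} {w} {w′} ev ew =
    Σ-cong K {λ k → v k * (w k * weight k)} {λ k → v′ k * (w′ k * weight k)} (λ k _ → *-cong (ev k) (*-congʳ (ew k)))

  form-symmetric : ∀ K v w → form K v w ≈ form K w v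
  form-symmetric K v w = Σ-cong K {λ k → v k * (w k * weight k)} {λ k → w k * (v k * weight k)}
    (λ k _ → solve 3 (λ x y z → x :* (y :* z) := y :* (x :* z)) refl (v k) (w k) (weight k))

  form-jacobi : ∀ K v w → v (suc K) ≈ 0# →
    form (suc K) (jacobi v) w ≈ δ * form K v (λ k → w (suc k)) + (β * form (suc K) v w + δ * form K (λ k → v (suc k)) w)
  form-jacobi K v w v-vanishes = begin
    form (suc K) (jacobi v) w
      ≈⟨ Σ-cong (suc K) {λ k → jacobi v k * (w k * weight k)}
           {λ k → mulZ v k * (w k * weight k) + (β * (v k * (w k * weight k)) + δ * (v (suc k) * (w k * weight k)))}
           (λ k _ → expand (mulZ v k) (v k) (v (suc k)) (w k * weight k)) ⟩
    Σ (suc K) (λ k → mulZ v k * (w k * weight k) + (β * (v k * (w k * weight k)) + δ * (v (suc k) * (w k * weight k))))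
      ≈⟨ trans (Σ-+ (suc K) t₀ (λ k → β * t₁ k + δ * t₂ k))
           (+-congˡ (trans (Σ-+ (suc K) (λ k → β * t₁ k) (λ k → δ * t₂ k)) (+-cong (Σ-*ˡ (suc K) β t₁) (Σ-*ˡ (suc K) δ t₂)))) ⟩
    form (suc K) (mulZ v) w + (β * form (suc K) v w + δ * form (suc K) (λ k → v (suc k)) w)
      ≈⟨ +-cong lowerDiagonal (+-congˡ (*-congˡ upperDiagonal)) ⟩
    δ * form K v (λ k → w (suc k)) + (β * form (suc K) v w + δ * form K (λ k → v (suc k)) w) ∎
    where
    t₀ t₁ t₂ : ℕ → Carrier
    t₀ k = mulZ v k * (w k * weight k)
    t₁ k = v k * (w k * weight k)
    t₂ k = v (suc k) * (w k * weight k)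
    expand : ∀ p q r x → (p + (β * q + δ * r)) * x ≈ p * x + (β * (q * x) + δ * (r * x))
    expand p q r x = solve 6 (λ p q r x β δ → (p :+ (β :* q :+ δ :* r)) :* x := p :* x :+ (β :* (q :* x) :+ δ :* (r :* x))) refl p q r x β δ
    -- the subdiagonal of J shifts the index, and weight (k+1) = δ · weight k
    lowerDiagonal : form (suc K) (mulZ v) w ≈ δ * form K v (λ k → w (suc k))
    lowerDiagonal = trans (trans (+-congʳ (zeroˡ _)) (+-identityˡ _))
      (trans (Σ-cong K {λ k → v k * (w (suc k) * weight (suc k))} {λ k → δ * (v k * (w (suc k) * weight k))}
                (λ k _ → solve 5 (λ x y b δ p → x :* (y :* (b :* (δ :* p))) := δ :* (x :* (y :* (b :* p)))) refl
                           (v k) (w (suc k)) b δ (pow δ k)))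
             (Σ-*ˡ K δ (λ k → v k * (w (suc k) * weight k))))
    upperDiagonal : form (suc K) (λ k → v (suc k)) w ≈ form K (λ k → v (suc k)) w
    upperDiagonal = trans (Σ-last K (λ k → v (suc k) * (w k * weight k)))
                          (trans (+-congˡ (trans (*-congʳ v-vanishes) (zeroˡ _))) (+-identityʳ _))

  jacobi-selfAdjoint : ∀ K v w → v (suc K) ≈ 0# → w (suc K) ≈ 0# →
    form (suc K) (jacobi v) w ≈ form (suc K) v (jacobi w)
  jacobi-selfAdjoint K v w v-vanishes w-vanishes = begin
    form (suc K) (jacobi v) w                                 ≈⟨ form-jacobi K v w v-vanishes ⟩
    δ * form K v w⁺ + (β * form (suc K) v w + δ * form K v⁺ w)
      ≈⟨ +-cong (*-congˡ (form-symmetric K v w⁺)) (+-cong (*-congˡ (form-symmetric (suc K) v w)) (*-congˡ (form-symmetric K v⁺ w))) ⟩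
    δ * form K w⁺ v + (β * form (suc K) w v + δ * form K w v⁺)
      ≈⟨ rotate _ _ _ ⟩
    δ * form K w v⁺ + (β * form (suc K) w v + δ * form K w⁺ v) ≈⟨ sym (form-jacobi K w v w-vanishes) ⟩
    form (suc K) (jacobi w) v                                 ≈⟨ form-symmetric (suc K) (jacobi w) v ⟩
    form (suc K) v (jacobi w)                                 ∎
    where
    v⁺ w⁺ : ℕ → Carrier
    v⁺ k = v (suc k)
    w⁺ k = w (suc k)
    rotate : ∀ p q r → p + (q + r) ≈ r + (q + p)
    rotate = solve 3 (λ p q r → p :+ (q :+ r) := r :+ (q :+ p)) refl

  B-orthogonality : ∀ i j K → i ℕ.+ j ℕ.< K → form K (B i) (B j) ≈ b * S (i ℕ.+ j)
  B-orthogonality zero j (suc K) _ = begin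
    B 0 0 * (B j 0 * weight 0) + Σ K (λ k → B 0 (suc k) * (B j (suc k) * weight (suc k)))
      ≈⟨ +-cong (*-cong (B-diagonal 0) (*-congʳ (B-column0 j)))
                (Σ-0 K (λ k → B 0 (suc k) * (B j (suc k) * weight (suc k))) (λ k _ → trans (*-congʳ (B-below 0 (suc k) (s≤s z≤n))) (zeroˡ _))) ⟩
    1# * (S j * (b * 1#)) + 0#     ≈⟨ trans (+-identityʳ _) (trans (*-identityˡ _) (trans (*-congˡ (*-identityʳ b)) (*-comm (S j) b))) ⟩
    b * S j                        ∎
  B-orthogonality (suc i) j (suc K) i+j<K = begin
    form (suc K) (B (suc i)) (B j)   ≈⟨ form-cong (suc K) {B (suc i)} {jacobi (B i)} {B j} {B j} (B-recurrence i) (λ k → refl) ⟩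
    form (suc K) (jacobi (B i)) (B j) ≈⟨ jacobi-selfAdjoint K (B i) (B j)
                                          (B-below i (suc K) (ℕP.≤-trans (ℕP.m≤m+n (suc i) j) (ℕP.<⇒≤ i+j<K)))
                                          (B-below j (suc K) (ℕP.≤-trans (s≤s (ℕP.m≤n+m j i)) (ℕP.<⇒≤ i+j<K))) ⟩
    form (suc K) (B i) (jacobi (B j)) ≈⟨ sym (form-cong (suc K) {B i} {B i} {B (suc j)} {jacobi (B j)} (λ k → refl) (B-recurrence j)) ⟩
    form (suc K) (B i) (B (suc j))   ≈⟨ B-orthogonality i (suc j) (suc K) (ℕP.≤-trans (s≤s (ℕP.≤-reflexive (ℕP.+-suc i j))) i+j<K) ⟩
    b * S (i ℕ.+ suc j)              ≡⟨ ≡.cong (λ e → b * S e) (ℕP.+-suc i j) ⟩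
    b * S (suc i ℕ.+ j)              ∎

module Residues (m′ : ℕ) where
  m : ℕ
  m = suc m′

  division : ∀ i → i ≡ i % m ℕ.+ m ℕ.* (i / m)
  division i = ≡.trans (DM.m≡m%n+[m/n]*n i m) (≡.cong (i % m ℕ.+_) (ℕP.*-comm (i / m) m))

  remainder-of : ∀ r q → r ℕ.< m → (r ℕ.+ m ℕ.* q) % m ≡ r
  remainder-of r q r<m = ≡.trans (DM.%-remove-+ʳ r (ND.m∣m*n q)) (DM.m<n⇒m%n≡m r<m)

  quotient-of : ∀ r q → r ℕ.< m → (r ℕ.+ m ℕ.* q) / m ≡ q
  quotient-of r q r<m = ≡.trans (DM.+-distrib-/-∣ʳ r (ND.m∣m*n q))
    (≡.cong₂ ℕ._+_ (DM.m<n⇒m/n≡0 r<m) (≡.trans (≡.cong (_/ m) (ℕP.*-comm m q)) (DM.m*n/n≡m q m)))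

  quotient-< : ∀ j q → j ℕ.< m ℕ.* q → j / m ℕ.< q
  quotient-< j q j<mq = DM.m<n*o⇒m/o<n (≡.subst (j ℕ.<_) (ℕP.*-comm m q) j<mq)

  remainder-shift : ∀ r e → 0 ℕ.< e → e ℕ.< m → (r ℕ.+ e) % m ≢ r
  remainder-shift r e 0<e e<m same = ℕP.<⇒≱ e<m (ND.∣⇒≤ {{ℕ.>-nonZero 0<e}} m∣e)
    where
    m∣e : m ∣ e
    m∣e = divides ((r ℕ.+ e) / m) (ℕP.+-cancelˡ-≡ r e _ (≡.trans (DM.m≡m%n+[m/n]*n (r ℕ.+ e) m)
                                     (≡.cong (ℕ._+ (r ℕ.+ e) / m ℕ.* m) same)))

  multiple-between : ∀ x → m ∣ x → 0 ℕ.< x → x ℕ.< m ℕ.+ m → x ≡ m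
  multiple-between x (divides zero x≡0) 0<x _ = ⊥-elim (ℕP.<⇒≢ 0<x (≡.sym x≡0))
  multiple-between x (divides (suc zero) x≡m) _ _ = ≡.trans x≡m (ℕP.+-identityʳ m)
  multiple-between x (divides (suc (suc k)) x≡) _ x<2m =
    ⊥-elim (ℕP.<⇒≱ x<2m (≡.subst (m ℕ.+ m ℕ.≤_) (≡.sym x≡) (ℕP.+-monoʳ-≤ m (ℕP.m≤m+n m (k ℕ.* m)))))

module SparseSeries {c ℓ : Level} (R : CommutativeRing c ℓ) (m′ : ℕ)
  (b : CommutativeRing.Carrier R) (f : Ops.PowerSeries R) (f-equation : Ops.SatisfiesEq R (suc m′) b f) where
  open CommutativeRing R
  open Ops R
  open FiniteSums R
  open PowerSeriesAlgebra R
  open Residues m′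
  open SetoidReasoning setoid

  <ᵇ-true : ∀ n a → n ℕ.< a → (n ℕ.<ᵇ a) ≡ true
  <ᵇ-true zero    (suc a) _         = ≡.refl
  <ᵇ-true (suc n) (suc a) (s≤s n<a) = <ᵇ-true n a n<a

  <ᵇ-false : ∀ a k → ((a ℕ.+ k) ℕ.<ᵇ a) ≡ false
  <ᵇ-false zero    k = ≡.refl
  <ᵇ-false (suc a) k = <ᵇ-false a k

  shift-below : ∀ g n → n ℕ.< m → shift m g n ≈ 0#
  shift-below g n n<m rewrite <ᵇ-true n m n<m = refl

  shift-above : ∀ g k → shift m g (m ℕ.+ k) ≈ g k
  shift-above g k rewrite <ᵇ-false m k | ℕP.m+n∸m≡n m k = refl

  Σ-residueClass : ∀ r q (g : ℕ → Carrier) → r ℕ.< m → (∀ i → i % m ≢ r → g i ≈ 0#) →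
    Σ (r ℕ.+ m ℕ.* q) g ≈ Σ q (λ k → g (r ℕ.+ m ℕ.* k))
  Σ-residueClass r q g r<m off = begin
    Σ (r ℕ.+ m ℕ.* q) g                             ≈⟨ Σ-split r (m ℕ.* q) g ⟩
    Σ r g + Σ (m ℕ.* q) (λ i → g (r ℕ.+ i))          ≈⟨ +-cong (Σ-0 r g (λ i i<r → off i (belowR i i<r))) (blocks q) ⟩
    0# + Σ q (λ k → g (r ℕ.+ m ℕ.* k))               ≈⟨ +-identityˡ _ ⟩
    Σ q (λ k → g (r ℕ.+ m ℕ.* k))                    ∎
    where
    belowR : ∀ i → i ℕ.< r → i % m ≢ r
    belowR i i<r i%m≡r = ℕP.<⇒≢ i<r (≡.trans (≡.sym (DM.m<n⇒m%n≡m (ℕP.<-trans i<r r<m))) i%m≡r)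
    block : ∀ q → Σ m (λ i → g (r ℕ.+ (m ℕ.* q ℕ.+ i))) ≈ g (r ℕ.+ m ℕ.* q)
    block q = trans (+-cong (reflexive (≡.cong (λ e → g (r ℕ.+ e)) (ℕP.+-identityʳ (m ℕ.* q))))
                            (Σ-0 m′ (λ e → g (r ℕ.+ (m ℕ.* q ℕ.+ suc e))) (λ e e<m′ → off _ (shifted (suc e) (s≤s z≤n) (s≤s e<m′)))))
                    (+-identityʳ _)
      where
      reassociate : ∀ a b e → a ℕ.+ e ℕ.+ b ≡ a ℕ.+ (b ℕ.+ e)
      reassociate = solve-∀
      shifted : ∀ e → 0 ℕ.< e → e ℕ.< m → (r ℕ.+ (m ℕ.* q ℕ.+ e)) % m ≢ r
      shifted e 0<e e<m = ≡.subst (_≢ r)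
        (≡.trans (≡.sym (DM.%-remove-+ʳ (r ℕ.+ e) (ND.m∣m*n q))) (≡.cong (_% m) (reassociate r (m ℕ.* q) e)))
        (remainder-shift r e 0<e e<m)
    blocks : ∀ q → Σ (m ℕ.* q) (λ i → g (r ℕ.+ i)) ≈ Σ q (λ k → g (r ℕ.+ m ℕ.* k))
    blocks zero    = reflexive (≡.cong (λ e → Σ e (λ i → g (r ℕ.+ i))) (ℕP.*-zeroʳ m))
    blocks (suc q) = begin
      Σ (m ℕ.* suc q) (λ i → g (r ℕ.+ i))              ≡⟨ ≡.cong (λ e → Σ e (λ i → g (r ℕ.+ i))) (ℕP.*-suc m q) ⟩
      Σ (m ℕ.+ m ℕ.* q) (λ i → g (r ℕ.+ i))            ≡⟨ ≡.cong (λ e → Σ e (λ i → g (r ℕ.+ i))) (ℕP.+-comm m (m ℕ.* q)) ⟩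
      Σ (m ℕ.* q ℕ.+ m) (λ i → g (r ℕ.+ i))            ≈⟨ Σ-split (m ℕ.* q) m (λ i → g (r ℕ.+ i)) ⟩
      Σ (m ℕ.* q) (λ i → g (r ℕ.+ i)) + Σ m (λ i → g (r ℕ.+ (m ℕ.* q ℕ.+ i)))
                                                       ≈⟨ +-cong (blocks q) (block q) ⟩
      Σ q (λ k → g (r ℕ.+ m ℕ.* k)) + g (r ℕ.+ m ℕ.* q) ≈⟨ sym (Σ-last q (λ k → g (r ℕ.+ m ℕ.* k))) ⟩
      Σ (suc q) (λ k → g (r ℕ.+ m ℕ.* k))              ∎

  -- f vanishes off the multiples of m; by strong induction on n, since every
  -- term f i f (k-i) of (f·f)(k), n = m + k, has a factor outside mℕ.
  f-sparse : ∀ n → ¬ (m ∣ n) → f n ≈ 0#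
  f-sparse n = below (suc n) n (ℕP.n<1+n n)
    where
    one-vanishes : ∀ n → ¬ (m ∣ n) → one n ≈ 0#
    one-vanishes zero    m∤0 = ⊥-elim (m∤0 (m ND.∣0))
    one-vanishes (suc n) _   = refl
    below : ∀ N n → n ℕ.< N → ¬ (m ∣ n) → f n ≈ 0#
    below (suc N) n (s≤s n≤N) m∤n with n ℕ.<? m
    ... | yes n<m = trans (f-equation n) (trans (+-cong (one-vanishes n m∤n)
                      (trans (*-congˡ (shift-below (f · f) n n<m)) (zeroʳ b))) (+-identityˡ 0#))
    ... | no  n≮m = trans (f-equation n) (trans (+-cong (one-vanishes n m∤n) (*-congˡ shifted))
                      (trans (+-identityˡ _) (trans (*-congˡ square-vanishes) (zeroʳ b))))
      where
      k = n ℕ.∸ m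
      n≡m+k : m ℕ.+ k ≡ n
      n≡m+k = ℕP.m+[n∸m]≡n (ℕP.≮⇒≥ n≮m)
      shifted : shift m (f · f) n ≈ (f · f) k
      shifted = trans (reflexive (≡.cong (shift m (f · f)) (≡.sym n≡m+k))) (shift-above (f · f) k)
      smaller : ∀ i → i ℕ.≤ k → i ℕ.< N
      smaller i i≤k = ℕP.≤-trans (s≤s i≤k) (ℕP.≤-trans (s≤s (ℕP.m≤n+m k m′)) (ℕP.≤-trans (ℕP.≤-reflexive n≡m+k) n≤N))
      term : ∀ i → i ℕ.≤ k → f i * f (k ℕ.∸ i) ≈ 0#
      term i i≤k with m ∣? i
      ... | no  m∤i = trans (*-congʳ (below N i (smaller i i≤k) m∤i)) (zeroˡ _)
      ... | yes m∣i = trans (*-congˡ (below N (k ℕ.∸ i) (smaller (k ℕ.∸ i) (ℕP.m∸n≤m k i)) m∤k-i)) (zeroʳ _)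
        where
        m∤k-i : ¬ (m ∣ (k ℕ.∸ i))
        m∤k-i m∣k-i = m∤n (≡.subst (m ∣_) (≡.trans (≡.cong (m ℕ.+_) (ℕP.m∸n+n≡m i≤k)) n≡m+k)
                                   (ND.∣m∣n⇒∣m+n (ND.∣-refl {m}) (ND.∣m∣n⇒∣m+n m∣k-i m∣i)))
      square-vanishes : (f · f) k ≈ 0#
      square-vanishes = Σ-0 (suc k) (λ i → f i * f (k ℕ.∸ i)) (λ i i≤k → term i (ℕP.≤-pred i≤k))

  Fm : PowerSeries
  Fm k = f (m ℕ.* k)

  square-atMultiples : ∀ k → (f · f) (m ℕ.* k) ≈ (Fm · Fm) k
  square-atMultiples k = begin
    Σ (suc (m ℕ.* k)) g                              ≈⟨ Σ-last (m ℕ.* k) g ⟩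
    Σ (0 ℕ.+ m ℕ.* k) g + g (m ℕ.* k)                ≈⟨ +-congʳ (Σ-residueClass 0 k g (s≤s z≤n) offMultiples) ⟩
    Σ k (λ k′ → g (m ℕ.* k′)) + g (m ℕ.* k)          ≈⟨ sym (Σ-last k (λ k′ → g (m ℕ.* k′))) ⟩
    Σ (suc k) (λ k′ → g (m ℕ.* k′))                  ≈⟨ Σ-cong (suc k) {λ k′ → g (m ℕ.* k′)} {λ k′ → Fm k′ * Fm (k ℕ.∸ k′)}
                                                          (λ k′ _ → *-congˡ (reflexive (≡.cong f (≡.sym (ℕP.*-distribˡ-∸ m k k′))))) ⟩
    (Fm · Fm) k                                       ∎
    where
    g : ℕ → Carrier
    g i = f i * f (m ℕ.* k ℕ.∸ i)
    offMultiples : ∀ i → i % m ≢ 0 → g i ≈ 0#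
    offMultiples i i%m≢0 = trans (*-congʳ (f-sparse i (λ m∣i → i%m≢0 (ND.n∣m⇒m%n≡0 i m m∣i)))) (zeroˡ _)

  Fm-equation : Fm ≋ (one ⊕ scale b (mulZ (Fm · Fm)))
  Fm-equation zero    = trans (reflexive (≡.cong f (ℕP.*-zeroʳ m)))
    (trans (f-equation 0) (+-congˡ (*-congˡ (shift-below (f · f) 0 (s≤s z≤n)))))
  Fm-equation (suc k) = trans (reflexive (≡.cong f (ℕP.*-suc m k)))
    (trans (f-equation (m ℕ.+ m ℕ.* k)) (+-congˡ (*-congˡ (trans (shift-above (f · f) (m ℕ.* k)) (square-atMultiples k)))))

module HankelFactorisation {c ℓ : Level} (R : CommutativeRing c ℓ) (m′ : ℕ)
  (b : CommutativeRing.Carrier R) (f : Ops.PowerSeries R) (f-equation : Ops.SatisfiesEq R (suc m′) b f) where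
  open CommutativeRing R
  open Ops R
  open FiniteSums R
  open Powers R
  open Determinants R
  open Corners R
  open Elimination R
  open Residues m′
  open SparseSeries R m′ b f f-equation
  open CatalanTable R b Fm Fm-equation
  open RingSolver commutativeSemiring using (solve; _:=_; _:*_)
  open SetoidReasoning setoid

  hankel : ℕMatrix
  hankel i j = f (suc (i ℕ.+ j))

  upper : ℕMatrix
  upper i j with suc (i % m ℕ.+ j % m) ℕ.≟ m
  ... | yes _ = weight (i / m) * B (j / m) (i / m)
  ... | no  _ = 0#

  upper-antidiagonal : ∀ r q s q′ → r ℕ.< m → s ℕ.< m → suc (r ℕ.+ s) ≡ m →
    upper (r ℕ.+ m ℕ.* q) (s ℕ.+ m ℕ.* q′) ≈ weight q * B q′ q
  upper-antidiagonal r q s q′ r<m s<m r+s+1≡m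
    with suc ((r ℕ.+ m ℕ.* q) % m ℕ.+ (s ℕ.+ m ℕ.* q′) % m) ℕ.≟ m
  ... | yes _ = reflexive (≡.cong₂ (λ a e → weight a * B e a) (quotient-of r q r<m) (quotient-of s q′ s<m))
  ... | no  ≢m = ⊥-elim (≢m (≡.trans (≡.cong₂ (λ a e → suc (a ℕ.+ e)) (remainder-of r q r<m) (remainder-of s q′ s<m)) r+s+1≡m))

  upper-offAntidiagonal : ∀ r q s q′ → r ℕ.< m → s ℕ.< m → suc (r ℕ.+ s) ≢ m →
    upper (r ℕ.+ m ℕ.* q) (s ℕ.+ m ℕ.* q′) ≈ 0#
  upper-offAntidiagonal r q s q′ r<m s<m r+s+1≢m
    with suc ((r ℕ.+ m ℕ.* q) % m ℕ.+ (s ℕ.+ m ℕ.* q′) % m) ℕ.≟ m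
  ... | yes ≡m = ⊥-elim (r+s+1≢m (≡.trans (≡.cong₂ (λ a e → suc (a ℕ.+ e)) (≡.sym (remainder-of r q r<m)) (≡.sym (remainder-of s q′ s<m))) ≡m))
  ... | no  _  = refl

  upper-belowBlocks : ∀ i j → j / m ℕ.< i / m → upper i j ≈ 0#
  upper-belowBlocks i j j/m<i/m with suc (i % m ℕ.+ j % m) ℕ.≟ m
  ... | yes _ = trans (*-congˡ (B-below (j / m) (i / m) j/m<i/m)) (zeroʳ _)
  ... | no  _ = refl

  lower : ℕMatrix
  lower i k with k % m ℕ.≟ i % m
  ... | yes _ = B (i / m) (k / m)
  ... | no  _ = 0#

  lower-sameResidue : ∀ r q q′ → r ℕ.< m → lower (r ℕ.+ m ℕ.* q) (r ℕ.+ m ℕ.* q′) ≈ B q q′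
  lower-sameResidue r q q′ r<m with (r ℕ.+ m ℕ.* q′) % m ℕ.≟ (r ℕ.+ m ℕ.* q) % m
  ... | yes _ = reflexive (≡.cong₂ B (quotient-of r q r<m) (quotient-of r q′ r<m))
  ... | no  ≢ = ⊥-elim (≢ (≡.trans (remainder-of r q′ r<m) (≡.sym (remainder-of r q r<m))))

  lower-otherResidue : ∀ i k → k % m ≢ i % m → lower i k ≈ 0#
  lower-otherResidue i k k≢i with k % m ℕ.≟ i % m
  ... | yes k≡i = ⊥-elim (k≢i k≡i)
  ... | no  _   = refl

  lower-combination : ∀ r q j → r ℕ.< m →
    Σ (r ℕ.+ m ℕ.* q) (λ k → lower (r ℕ.+ m ℕ.* q) k * upper k j) ≈ Σ q (λ k′ → B q k′ * upper (r ℕ.+ m ℕ.* k′) j)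
  lower-combination r q j r<m = trans
    (Σ-residueClass r q (λ k → lower (r ℕ.+ m ℕ.* q) k * upper k j) r<m
      (λ k k≢r → trans (*-congʳ (lower-otherResidue _ k (λ e → k≢r (≡.trans e (remainder-of r q r<m))))) (zeroˡ _)))
    (Σ-cong q {λ k′ → lower (r ℕ.+ m ℕ.* q) (r ℕ.+ m ℕ.* k′) * upper (r ℕ.+ m ℕ.* k′) j}
              {λ k′ → B q k′ * upper (r ℕ.+ m ℕ.* k′) j}
      (λ k′ _ → *-congʳ (lower-sameResidue r q k′ r<m)))

  Factorises : ℕ → ℕ → Set ℓ
  Factorises i j = hankel i j ≈ upper i j + Σ i (λ k → lower i k * upper k j)

  -- On the antidiagonal blocks this is the orthogonality of the table B.
  factorisation-antidiagonal : ∀ r q s q′ → r ℕ.< m → s ℕ.< m → suc (r ℕ.+ s) ≡ m →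
    Factorises (r ℕ.+ m ℕ.* q) (s ℕ.+ m ℕ.* q′)
  factorisation-antidiagonal r q s q′ r<m s<m r+s+1≡m = sym (begin
    upper i j + Σ i (λ k → lower i k * upper k j)
      ≈⟨ +-cong (upper-antidiagonal r q s q′ r<m s<m r+s+1≡m)
                (trans (lower-combination r q j r<m)
                       (Σ-cong q {λ k′ → B q k′ * upper (r ℕ.+ m ℕ.* k′) j} {term}
                          (λ k′ _ → *-congˡ (trans (upper-antidiagonal r k′ s q′ r<m s<m r+s+1≡m) (*-comm _ _))))) ⟩
    weight q * B q′ q + Σ q term
      ≈⟨ trans (+-comm _ _) (+-congˡ (trans (sym (*-identityˡ _)) (*-cong (sym (B-diagonal q)) (*-comm _ _)))) ⟩
    Σ q term + term q                         ≈⟨ sym (Σ-last q term) ⟩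
    form (suc q) (B q) (B q′)                 ≈⟨ sym (Σ-extend (suc q) q′ term (λ k q<k _ → trans (*-congʳ (B-below q k q<k)) (zeroˡ _))) ⟩
    form (suc q ℕ.+ q′) (B q) (B q′)          ≈⟨ B-orthogonality q q′ (suc q ℕ.+ q′) (ℕP.n<1+n (q ℕ.+ q′)) ⟩
    b * S (q ℕ.+ q′)                          ≈⟨ trans (sym (+-identityˡ _)) (sym (Fm-equation (suc (q ℕ.+ q′)))) ⟩
    f (m ℕ.* suc (q ℕ.+ q′))                  ≡⟨ ≡.cong f (≡.sym index) ⟩
    hankel i j                                ∎)
    where
    i = r ℕ.+ m ℕ.* q
    j = s ℕ.+ m ℕ.* q′
    term : ℕ → Carrier
    term k = B q k * (B q′ k * weight k)
    regroup : ∀ r q s q′ → suc ((r ℕ.+ m ℕ.* q) ℕ.+ (s ℕ.+ m ℕ.* q′)) ≡ suc (r ℕ.+ s) ℕ.+ m ℕ.* (q ℕ.+ q′)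
    regroup = solve-∀
    index : suc (i ℕ.+ j) ≡ m ℕ.* suc (q ℕ.+ q′)
    index = ≡.trans (regroup r q s q′) (≡.trans (≡.cong (ℕ._+ m ℕ.* (q ℕ.+ q′)) r+s+1≡m) (≡.sym (ℕP.*-suc m (q ℕ.+ q′))))

  -- Off the antidiagonal blocks both sides vanish, since then m ∤ i + j + 1.
  factorisation-offAntidiagonal : ∀ r q s q′ → r ℕ.< m → s ℕ.< m → suc (r ℕ.+ s) ≢ m →
    Factorises (r ℕ.+ m ℕ.* q) (s ℕ.+ m ℕ.* q′)
  factorisation-offAntidiagonal r q s q′ r<m s<m r+s+1≢m = begin
    hankel i j                                 ≈⟨ f-sparse (suc (i ℕ.+ j)) m∤ ⟩
    0#                                         ≈⟨ sym (+-identityˡ 0#) ⟩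
    0# + 0#                                    ≈⟨ sym (+-cong (upper-offAntidiagonal r q s q′ r<m s<m r+s+1≢m)
                                                      (trans (lower-combination r q j r<m)
                                                        (Σ-0 q (λ k′ → B q k′ * upper (r ℕ.+ m ℕ.* k′) j)
                                                          (λ k′ _ → trans (*-congˡ (upper-offAntidiagonal r k′ s q′ r<m s<m r+s+1≢m)) (zeroʳ _))))) ⟩
    upper i j + Σ i (λ k → lower i k * upper k j) ∎
    where
    i = r ℕ.+ m ℕ.* q
    j = s ℕ.+ m ℕ.* q′
    regroup : ∀ r q s q′ → suc ((r ℕ.+ m ℕ.* q) ℕ.+ (s ℕ.+ m ℕ.* q′)) ≡ m ℕ.* (q ℕ.+ q′) ℕ.+ suc (r ℕ.+ s)
    regroup = solve-∀
    m∤ : ¬ (m ∣ suc (i ℕ.+ j))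
    m∤ m∣ = r+s+1≢m (multiple-between (suc (r ℕ.+ s))
      (ND.∣m+n∣m⇒∣n (≡.subst (m ∣_) (regroup r q s q′) m∣) (ND.m∣m*n (q ℕ.+ q′)))
      (s≤s z≤n) (ℕP.≤-trans (s≤s (ℕP.+-monoˡ-≤ s r<m)) (ℕP.+-monoʳ-< m s<m)))

  factorisation : ∀ i j → Factorises i j
  factorisation i j = ≡.subst₂ Factorises (≡.sym (division i)) (≡.sym (division j)) (byCases (suc (r ℕ.+ s) ℕ.≟ m))
    where
    r = i % m
    s = j % m
    byCases : Dec (suc (r ℕ.+ s) ≡ m) → Factorises (r ℕ.+ m ℕ.* (i / m)) (s ℕ.+ m ℕ.* (j / m))
    byCases (yes ≡m) = factorisation-antidiagonal r (i / m) s (j / m) (DM.m%n<n i m) (DM.m%n<n j m) ≡m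
    byCases (no  ≢m) = factorisation-offAntidiagonal r (i / m) s (j / m) (DM.m%n<n i m) (DM.m%n<n j m) ≢m

  d₁≈det-upper : ∀ N → d₁ f N ≈ det N (corner N upper)
  d₁≈det-upper N = det-unitriangular N hankel upper lower (λ i j _ → factorisation i j)

  -- If m ∤ N, row m⌊N/m⌋ of U_N vanishes: its entries left of the diagonal
  -- block lie below the blocks, and within reach of column N it never meets
  -- the antidiagonal.
  det-upper-nonMultiple : ∀ N → ¬ (m ∣ N) → det N (corner N upper) ≈ 0#
  det-upper-nonMultiple N m∤N = det-zeroRow N (corner N upper) row
    (λ j → trans (reflexive (≡.cong (λ a → upper a (toℕ j)) (FP.toℕ-fromℕ< row<N))) (rowVanishes (toℕ j) (FP.toℕ<n j)))
    where
    t = N % m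
    q = N / m
    0<t : 0 ℕ.< t
    0<t = ℕP.n≢0⇒n>0 (λ t≡0 → m∤N (ND.m%n≡0⇒n∣m N m t≡0))
    row<N : m ℕ.* q ℕ.< N
    row<N = ≡.subst (m ℕ.* q ℕ.<_) (≡.sym (division N)) (ℕP.m<n+m (m ℕ.* q) 0<t)
    row : Fin N
    row = F.fromℕ< row<N
    rowVanishes : ∀ j → j ℕ.< N → upper (m ℕ.* q) j ≈ 0#
    rowVanishes j j<N with j / m ℕ.<? q
    ... | yes j/m<q = upper-belowBlocks (m ℕ.* q) j (≡.subst (j / m ℕ.<_) (≡.sym (quotient-of 0 q (s≤s z≤n))) j/m<q)
    ... | no  j/m≮q = ≡.subst (λ e → upper (m ℕ.* q) e ≈ 0#) (≡.sym (division j))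
                        (upper-offAntidiagonal 0 q (j % m) (j / m) (s≤s z≤n) (DM.m%n<n j m) notLast)
      where
      -- column j would have to be at least m′ + mq ≥ t + mq = N
      notLast : suc (j % m) ≢ m
      notLast e = ℕP.<⇒≱ j<N (ℕP.≤-trans (ℕP.≤-reflexive (division N)) (ℕP.≤-trans
        (ℕP.+-mono-≤ (ℕP.≤-pred (DM.m%n<n N m)) (ℕP.*-monoʳ-≤ m (ℕP.≮⇒≥ j/m≮q)))
        (ℕP.≤-reflexive (≡.trans (≡.cong (ℕ._+ m ℕ.* (j / m)) (≡.sym (ℕP.suc-injective e))) (≡.sym (division j))))))

  -- Peeling off the last block of U_{m(n+1)} one row at a time: peeled n v
  -- keeps the first mn columns of U and the last v columns of block n.
  peelColumn : ℕ → ℕ → ℕ → ℕ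
  peelColumn n v j with j ℕ.<? m ℕ.* n
  ... | yes _ = j
  ... | no  _ = j ℕ.+ (m ℕ.∸ v)

  peelColumn-< : ∀ n v j → j ℕ.< m ℕ.* n → peelColumn n v j ≡ j
  peelColumn-< n v j j<mn with j ℕ.<? m ℕ.* n
  ... | yes _    = ≡.refl
  ... | no  j≮mn = ⊥-elim (j≮mn j<mn)

  peelColumn-≥ : ∀ n v j → ¬ (j ℕ.< m ℕ.* n) → peelColumn n v j ≡ j ℕ.+ (m ℕ.∸ v)
  peelColumn-≥ n v j j≮mn with j ℕ.<? m ℕ.* n
  ... | yes j<mn = ⊥-elim (j≮mn j<mn)
  ... | no  _    = ≡.refl

  peeled : ℕ → ℕ → ℕMatrix
  peeled n v i j = upper i (peelColumn n v j)

  -- In peeled n (v+1), the last row v + mn has a single nonzero entry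
  -- b^(2n+1), in column mn; deleting that column leaves peeled n v.
  module PeelStep (n v : ℕ) (v<m : v ℕ.< m) where
    x : ℕ
    x = m ℕ.∸ suc v

    v+x+1≡m : suc (v ℕ.+ x) ≡ m
    v+x+1≡m = ≡.trans (≡.sym (ℕP.+-suc v x)) (≡.trans (≡.cong (v ℕ.+_) (≡.sym (ℕP.+-∸-assoc 1 v<m))) (ℕP.m+[n∸m]≡n (ℕP.<⇒≤ v<m)))

    lastRow : ℕ
    lastRow = m ℕ.* n ℕ.+ v

    lastRow≡ : lastRow ≡ v ℕ.+ m ℕ.* n
    lastRow≡ = ℕP.+-comm (m ℕ.* n) v

    lastRow-entry : peeled n (suc v) lastRow (m ℕ.* n) ≈ weight n
    lastRow-entry = begin
      upper lastRow (peelColumn n (suc v) (m ℕ.* n))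
        ≡⟨ ≡.cong₂ upper lastRow≡ (≡.trans (peelColumn-≥ n (suc v) (m ℕ.* n) (ℕP.<-irrefl ≡.refl)) (ℕP.+-comm (m ℕ.* n) x)) ⟩
      upper (v ℕ.+ m ℕ.* n) (x ℕ.+ m ℕ.* n)  ≈⟨ upper-antidiagonal v n x n v<m (s≤s (ℕP.m∸n≤m m′ v)) v+x+1≡m ⟩
      weight n * B n n                        ≈⟨ trans (*-congˡ (B-diagonal n)) (*-identityʳ _) ⟩
      weight n                                ∎

    lastRow-single : ∀ j → j ℕ.≤ lastRow → j ≢ m ℕ.* n → peeled n (suc v) lastRow j ≈ 0#
    lastRow-single j j≤lastRow j≢mn = byCases (j ℕ.<? m ℕ.* n)
      where
      byCases : Dec (j ℕ.< m ℕ.* n) → peeled n (suc v) lastRow j ≈ 0#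
      byCases (yes j<mn) = trans (reflexive (≡.cong₂ upper lastRow≡ (peelColumn-< n (suc v) j j<mn)))
                            (upper-belowBlocks (v ℕ.+ m ℕ.* n) j
                               (≡.subst (j / m ℕ.<_) (≡.sym (quotient-of v n v<m)) (quotient-< j n j<mn)))
      byCases (no  j≮mn) = trans (reflexive (≡.cong₂ upper lastRow≡ (≡.trans (peelColumn-≥ n (suc v) j j≮mn) column≡)))
                            (upper-offAntidiagonal v n (e ℕ.+ x) n v<m e+x<m offAntidiagonal)
        where
        -- column j = mn + e with 0 < e ≤ v lands in column mn + e + x of U
        e = j ℕ.∸ m ℕ.* n
        mn<j : m ℕ.* n ℕ.< j
        mn<j = ℕP.≤∧≢⇒< (ℕP.≮⇒≥ j≮mn) (λ mn≡j → j≢mn (≡.sym mn≡j))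
        0<e : 0 ℕ.< e
        0<e = ℕP.m<n⇒0<n∸m mn<j
        e≤v : e ℕ.≤ v
        e≤v = ℕP.≤-trans (ℕP.∸-monoˡ-≤ (m ℕ.* n) j≤lastRow) (ℕP.≤-reflexive (ℕP.m+n∸m≡n (m ℕ.* n) v))
        e+x<m : e ℕ.+ x ℕ.< m
        e+x<m = ℕP.≤-trans (s≤s (ℕP.+-monoˡ-≤ x e≤v)) (ℕP.≤-reflexive v+x+1≡m)
        column≡ : j ℕ.+ x ≡ e ℕ.+ x ℕ.+ m ℕ.* n
        column≡ = ≡.trans (≡.cong (ℕ._+ x) (≡.sym (ℕP.m∸n+n≡m (ℕP.<⇒≤ mn<j)))) (regroup e (m ℕ.* n) x)
          where
          regroup : ∀ e a x → e ℕ.+ a ℕ.+ x ≡ e ℕ.+ x ℕ.+ a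
          regroup = solve-∀
        offAntidiagonal : suc (v ℕ.+ (e ℕ.+ x)) ≢ m
        offAntidiagonal eq = ℕP.<⇒≢ 0<e (≡.sym (ℕP.+-cancelʳ-≡ m e 0 (≡.trans (≡.sym shifted) eq)))
          where
          regroup : ∀ e x v → suc (v ℕ.+ (e ℕ.+ x)) ≡ e ℕ.+ suc (v ℕ.+ x)
          regroup = solve-∀
          shifted : suc (v ℕ.+ (e ℕ.+ x)) ≡ e ℕ.+ m
          shifted = ≡.trans (regroup e x v) (≡.cong (e ℕ.+_) v+x+1≡m)

    deleteColumn-peeled : ∀ i j → deleteColumn (m ℕ.* n) (peeled n (suc v)) i j ≈ peeled n v i j
    deleteColumn-peeled i j = byCases (j ℕ.<? m ℕ.* n)
      where
      byCases : Dec (j ℕ.< m ℕ.* n) → deleteColumn (m ℕ.* n) (peeled n (suc v)) i j ≈ peeled n v i j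
      byCases (yes j<mn) = trans (deleteColumn-< (m ℕ.* n) _ i j j<mn)
        (reflexive (≡.cong (upper i) (≡.trans (peelColumn-< n (suc v) j j<mn) (≡.sym (peelColumn-< n v j j<mn)))))
      byCases (no  j≮mn) = trans (deleteColumn-≥ (m ℕ.* n) _ i j j≮mn)
        (reflexive (≡.cong (upper i) (≡.trans (peelColumn-≥ n (suc v) (suc j) (λ j+1<mn → j≮mn (ℕP.<-trans (ℕP.n<1+n j) j+1<mn)))
          (≡.trans (≡.trans (≡.sym (ℕP.+-suc j x)) (≡.cong (j ℕ.+_) (≡.sym (ℕP.+-∸-assoc 1 v<m))))
                   (≡.sym (peelColumn-≥ n v j j≮mn))))))

  -- Pascal's rule for C(·,2): the signs accumulated while peeling.
  C2-suc : ∀ v → suc v C 2 ≡ v C 2 ℕ.+ v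
  C2-suc v = ≡.trans (≡.sym (nCk+nC[k+1]≡[n+1]C[k+1] v 1)) (≡.trans (≡.cong (ℕ._+ v C 2) (nC1≡n v)) (ℕP.+-comm v (v C 2)))

  det-peeled : ∀ n v → v ℕ.≤ m →
    det (m ℕ.* n ℕ.+ v) (corner _ (peeled n v)) ≈ signPow (v C 2) * (pow (weight n) v * det (m ℕ.* n) (corner _ upper))
  det-peeled n zero _ = begin
    det (m ℕ.* n ℕ.+ 0) (corner _ (peeled n 0))   ≈⟨ det-corner-resize (peeled n 0) (ℕP.+-identityʳ (m ℕ.* n)) ⟩
    det (m ℕ.* n) (corner _ (peeled n 0))         ≈⟨ det-corner-cong (m ℕ.* n) (peeled n 0) upper
                                                       (λ i j _ j<mn → reflexive (≡.cong (upper i) (peelColumn-< n 0 j j<mn))) ⟩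
    det (m ℕ.* n) (corner _ upper)                ≈⟨ sym (trans (*-identityˡ _) (*-identityˡ _)) ⟩
    signPow 0 * (pow (weight n) 0 * det (m ℕ.* n) (corner _ upper)) ∎
  det-peeled n (suc v) v<m = begin
    det (m ℕ.* n ℕ.+ suc v) (corner _ (peeled n (suc v)))
      ≈⟨ det-corner-resize (peeled n (suc v)) (ℕP.+-suc (m ℕ.* n) v) ⟩
    det (suc lastRow) (corner _ (peeled n (suc v)))
      ≈⟨ det-lastRowSingle lastRow (peeled n (suc v)) (m ℕ.* n) (ℕP.m≤m+n (m ℕ.* n) v) lastRow-single ⟩
    signPow lastRow * (signPow (m ℕ.* n) * (peeled n (suc v) lastRow (m ℕ.* n) * det lastRow (corner _ (deleteColumn (m ℕ.* n) (peeled n (suc v))))))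
      ≈⟨ *-congˡ (*-congˡ (*-cong lastRow-entry (trans (det-corner-cong lastRow _ _ (λ i j _ _ → deleteColumn-peeled i j))
                                                    (det-peeled n v (ℕP.<⇒≤ v<m))))) ⟩
    signPow lastRow * (signPow (m ℕ.* n) * (w * (signPow (v C 2) * (pow w v * D))))
      ≈⟨ signPow-shift (m ℕ.* n) v _ ⟩
    signPow v * (w * (signPow (v C 2) * (pow w v * D)))
      ≈⟨ solve 5 (λ s w t p D → s :* (w :* (t :* (p :* D))) := (t :* s) :* ((w :* p) :* D)) refl (signPow v) w (signPow (v C 2)) (pow w v) D ⟩
    (signPow (v C 2) * signPow v) * (pow w (suc v) * D)
      ≈⟨ *-congʳ (trans (sym (signPow-+ (v C 2) v)) (reflexive (≡.cong signPow (≡.sym (C2-suc v))))) ⟩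
    signPow (suc v C 2) * (pow w (suc v) * D) ∎
    where
    open PeelStep n v v<m
    w = weight n
    D = det (m ℕ.* n) (corner _ upper)

  det-upper-multiple : ∀ n → det (m ℕ.* n) (corner _ upper) ≈ signPow ((m C 2) ℕ.* n) * pow b (m ℕ.* (n ℕ.* n))
  det-upper-multiple zero = begin
    det (m ℕ.* 0) (corner _ upper)       ≈⟨ det-corner-resize upper (ℕP.*-zeroʳ m) ⟩
    1#                                   ≈⟨ sym (*-identityˡ 1#) ⟩
    1# * 1#                              ≡⟨ ≡.sym (≡.cong₂ (λ a e → signPow a * pow b e) (ℕP.*-zeroʳ (m C 2)) (ℕP.*-zeroʳ m)) ⟩
    signPow ((m C 2) ℕ.* 0) * pow b (m ℕ.* 0) ∎
  det-upper-multiple (suc n) = begin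
    det (m ℕ.* suc n) (corner _ upper)
      ≈⟨ det-corner-resize upper (≡.trans (ℕP.*-suc m n) (ℕP.+-comm m (m ℕ.* n))) ⟩
    det (m ℕ.* n ℕ.+ m) (corner _ upper)
      ≈⟨ det-corner-cong (m ℕ.* n ℕ.+ m) upper (peeled n m) (λ i j _ _ → reflexive (≡.cong (upper i) (≡.sym (wholeBlock j)))) ⟩
    det (m ℕ.* n ℕ.+ m) (corner _ (peeled n m))
      ≈⟨ det-peeled n m ℕP.≤-refl ⟩
    signPow (m C 2) * (pow (weight n) m * det (m ℕ.* n) (corner _ upper))
      ≈⟨ *-congˡ (*-cong (trans (pow-cong m (weight-as-pow n)) (sym (pow-* b (suc (n ℕ.+ n)) m))) (det-upper-multiple n)) ⟩
    signPow (m C 2) * (pow b (suc (n ℕ.+ n) ℕ.* m) * (signPow ((m C 2) ℕ.* n) * pow b (m ℕ.* (n ℕ.* n))))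
      ≈⟨ solve 4 (λ s p t q → s :* (p :* (t :* q)) := (s :* t) :* (p :* q)) refl _ _ _ _ ⟩
    (signPow (m C 2) * signPow ((m C 2) ℕ.* n)) * (pow b (suc (n ℕ.+ n) ℕ.* m) * pow b (m ℕ.* (n ℕ.* n)))
      ≈⟨ sym (*-cong (trans (reflexive (≡.cong signPow (ℕP.*-suc (m C 2) n))) (signPow-+ (m C 2) ((m C 2) ℕ.* n)))
                     (trans (reflexive (≡.cong (pow b) (exponent n m))) (pow-+ b (suc (n ℕ.+ n) ℕ.* m) (m ℕ.* (n ℕ.* n))))) ⟩
    signPow ((m C 2) ℕ.* suc n) * pow b (m ℕ.* (suc n ℕ.* suc n)) ∎
    where
    wholeBlock : ∀ j → peelColumn n m j ≡ j
    wholeBlock j with j ℕ.<? m ℕ.* n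
    ... | yes _ = ≡.refl
    ... | no  _ = ≡.trans (≡.cong (j ℕ.+_) (ℕP.n∸n≡0 m)) (ℕP.+-identityʳ j)
    exponent : ∀ k a → a ℕ.* (suc k ℕ.* suc k) ≡ suc (k ℕ.+ k) ℕ.* a ℕ.+ a ℕ.* (k ℕ.* k)
    exponent = solve-∀

  d₁-multiple : ∀ n → d₁ f (m ℕ.* n) ≈ signPow ((m C 2) ℕ.* n) * pow b (m ℕ.* (n ℕ.* n))
  d₁-multiple n = trans (d₁≈det-upper (m ℕ.* n)) (det-upper-multiple n)

  d₁-nonMultiple : ∀ N → ¬ (m ∣ N) → d₁ f N ≈ 0#
  d₁-nonMultiple N m∤N = trans (d₁≈det-upper N) (det-upper-nonMultiple N m∤N)

theorem5p6 : ∀ {c ℓ : Level} (R : CommutativeRing c ℓ) (m : ℕ) → 1 ℕ.≤ m →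
    (b : CommutativeRing.Carrier R) (f : Ops.PowerSeries R) →
    Ops.SatisfiesEq R m b f →
    ((n : ℕ) → CommutativeRing._≈_ R (Ops.d₁ R f (m ℕ.* n))
        (CommutativeRing._*_ R (Ops.signPow R ((m C 2) ℕ.* n)) (Ops.pow R b (m ℕ.* (n ℕ.* n)))))
    × ((N : ℕ) → ¬ (m ∣ N) → CommutativeRing._≈_ R (Ops.d₁ R f N) (CommutativeRing.0# R))
theorem5p6 R (suc m′) _ b f f-equation = d₁-multiple , d₁-nonMultiple
  where open HankelFactorisation R m′ b f f-equation
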